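{- Let $G_1$ and $G_2$ be disjoint Eulerian graphs, $w_i\in V(G_i)$, and $e_i\in E(G_i)$ with end vertices $u_i,v_i$ ($i=1,2$). Then (i) $c((G_1,w_1)\odot_V(G_2,w_2))=c(G_1)+c(G_2)$ and $\nu((G_1,w_1)\odot_V(G_2,w_2))=\nu(G_1)+\nu(G_2)$; (ii) $c((G_1,e_1,u_1)\odot_E(G_2,e_2,u_2))=c((G_1,e_1,u_1)\odot_{VE}(G_2,e_2,u_2))=c(G_1)+c(G_2)-1$ and $\nu((G_1,e_1,u_1)\odot_E(G_2,e_2,u_2))=\nu((G_1,e_1,u_1)\odot_{VE}(G_2,e_2,u_2))=\nu(G_1)+\nu(G_2)-1$.
   Context: Graphs are finite, loopless, parallel edges allowed. A graph is Eulerian if it has a closed walk $v_0e_0v_1\dots e_{k-1}v_k$ with $v_0=v_k$ containing every edge exactly once. A cycle is a graph obtained from a path $u_0\dots u_k$ ($k\ge1$) by adding an edge $u_ku_0$ (two parallel edges form a cycle). A cycle decomposition of $G$ is a set of cycle subgraphs of $G$ such that each edge lies in exactly one; $c(G)$, $\nu(G)$ are the minimum and maximum number of cycles in a cycle decomposition. Operations on disjoint $G_1,G_2$: $(G_1,w_1)\odot_V(G_2,w_2)$ identifies $w_1$ and $w_2$; $(G_1,e_1,u_1)\odot_E(G_2,e_2,u_2)$ deletes $e_1,e_2$ and adds an edge $u_1u_2$ and an edge $v_1v_2$; $(G_1,e_1,u_1)\odot_{VE}(G_2,e_2,u_2)$ deletes $e_1,e_2$, identifies $v_1$ with $v_2$,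 and adds an edge $u_1u_2$. -}

module Defs where

open import Data.Nat using (ℕ; zero; suc; _+_; _≤_)
open import Data.Fin using (Fin; zero; suc; inject₁; fromℕ)
open import Data.Fin.Properties using () renaming (_≟_ to _≟F_)
open import Data.Product using (Σ; _×_; _,_; proj₁; proj₂)
open import Data.Sum using (_⊎_; inj₁; inj₂)
open import Data.Unit using (⊤; tt)
open import Relation.Binary.PropositionalEquality using (_≡_; _≢_; refl; sym; trans; cong)
open import Relation.Binary.Definitions using (DecidableEquality)
open import Relation.Nullary using (yes; no)
open import Function.Bundles using (_↔_; Inverse)
open import Function.Definitions using (Injective; Bijective)

-- Multigraphs (parallel edges allowed).  Each edge has an ordered pair of
-- end vertices; the orientation carries no meaning (see `Joins`).

record Graph : Set₁ where
  field
    V    : Set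
    E    : Set
    ends : E → V × V

open Graph public

Joins : (G : Graph) → E G → V G → V G → Set
Joins G e x y = (ends G e ≡ (x , y)) ⊎ (ends G e ≡ (y , x))

Loopless : Graph → Set
Loopless G = ∀ e → proj₁ (ends G e) ≢ proj₂ (ends G e)

Finite : Graph → Set
Finite G = (Σ ℕ λ n → V G ↔ Fin n) × (Σ ℕ λ m → E G ↔ Fin m)

-- Eulerian: closed walk v₀ e₀ v₁ … e_{k-1} v_k, v₀ = v_k, using every
-- edge exactly once (i.e. i ↦ eᵢ is a bijection Fin k → E).

record ClosedEulerWalk (G : Graph) : Set where
  field
    len   : ℕ
    verts : Fin (suc len) → V G
    edges : Fin len → E G
    step  : ∀ i → Joins G (edges i) (verts (inject₁ i)) (verts (suc i))
    closed : verts zero ≡ verts (fromℕ len)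
    once  : Bijective _≡_ _≡_ edges

Eulerian : Graph → Set
Eulerian G = ClosedEulerWalk G

-- Cycle subgraph: a path u₀ … u_k (k ≥ 1, distinct vertices) with path
-- edges pᵢ = uᵢu_{i+1} together with a closing edge c = u_k u₀; all k+1
-- edges distinct (for k = 1 this is a pair of parallel edges).

consFin : {A : Set} {k : ℕ} → A → (Fin k → A) → Fin (suc k) → A
consFin a f zero    = a
consFin a f (suc i) = f i

record Cycle (G : Graph) : Set where
  field
    k          : ℕ
    k≥1        : 1 ≤ k
    verts      : Fin (suc k) → V G
    vertsInj   : Injective _≡_ _≡_ verts
    pathEdge   : Fin k → E G
    pathJoins  : ∀ i → Joins G (pathEdge i) (verts (inject₁ i)) (verts (suc i))
    closeEdge  : E G
    closeJoins : Joins G closeEdge (verts (fromℕ k)) (verts zero)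

    edgesInj : Injective _≡_ _≡_ (consFin closeEdge pathEdge)

cedges : {G : Graph} (C : Cycle G) → Fin (suc (Cycle.k C)) → E G
cedges C = consFin (Cycle.closeEdge C) (Cycle.pathEdge C)


-- Cycle decomposition: a family of `count` cycles such that every edge of G
-- lies in exactly one of them (the map (j , i) ↦ i-th edge of cycle j is a
-- bijection onto E G).
record CycleDecomposition (G : Graph) : Set where
  field
    count  : ℕ
    cycles : Fin count → Cycle G
    exact  : Bijective _≡_ _≡_
               (λ (p : Σ (Fin count) λ j → Fin (suc (Cycle.k (cycles j)))) →
                  cedges (cycles (proj₁ p)) (proj₂ p))

open CycleDecomposition public using (count)

-- c(G) = a  and  ν(G) = b
IsMinCycleNumber : Graph → ℕ → Set
IsMinCycleNumber G a =
  (Σ (CycleDecomposition G) λ D → count D ≡ a) × (∀ (D : CycleDecomposition G) → a ≤ count D)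

IsMaxCycleNumber : Graph → ℕ → Set
IsMaxCycleNumber G b =
  (Σ (CycleDecomposition G) λ D → count D ≡ b) × (∀ (D : CycleDecomposition G) → count D ≤ b)

-- A type with one element removed (proof irrelevant, so elements are equal
-- iff their underlying elements are).

record _∖_ (A : Set) (a : A) : Set where
  constructor ⟨_,_⟩
  field
    elt : A
    .ne : elt ≢ a

open _∖_ public

finDecEq : {A : Set} {n : ℕ} → A ↔ Fin n → DecidableEquality A
finDecEq {A} f x y with Inverse.to f x ≟F Inverse.to f y
... | yes p = yes (trans (sym (Inverse.strictlyInverseʳ f x))
                    (trans (cong (Inverse.from f) p) (Inverse.strictlyInverseʳ f y)))
... | no ¬p = no (λ q → ¬p (cong (Inverse.to f) q))

-- Operations on disjoint graphs (disjointness is built in by taking the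
-- disjoint union of vertex and edge types).

glue : {V₁ V₂ : Set} → DecidableEquality V₂ → (w : V₂) → V₁ → V₂ → V₁ ⊎ (V₂ ∖ w)
glue dec w w' x with dec x w
... | yes _ = inj₁ w'
... | no p  = inj₂ ⟨ x , p ⟩

pair : {A B : Set} → (A → B) → A × A → B × B
pair f (x , y) = (f x , f y)

joinV : (G₁ : Graph) → V G₁ → (G₂ : Graph) → DecidableEquality (V G₂) → V G₂ → Graph
joinV G₁ w₁ G₂ dec w₂ = record
  { V = V G₁ ⊎ (V G₂ ∖ w₂)
  ; E = E G₁ ⊎ E G₂
  ; ends = λ { (inj₁ e) → pair inj₁ (ends G₁ e)
             ; (inj₂ e) → pair (glue dec w₂ w₁) (ends G₂ e) } }

-- (G₁ , e₁ , u₁) ⊙_E (G₂ , e₂ , u₂), where vᵢ is the other end of eᵢ: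
-- delete e₁, e₂, add edges u₁u₂ and v₁v₂
joinE : (G₁ : Graph) → E G₁ → V G₁ → V G₁ →
        (G₂ : Graph) → E G₂ → V G₂ → V G₂ → Graph
joinE G₁ e₁ u₁ v₁ G₂ e₂ u₂ v₂ = record
  { V = V G₁ ⊎ V G₂
  ; E = (E G₁ ∖ e₁) ⊎ ((E G₂ ∖ e₂) ⊎ (⊤ ⊎ ⊤))
  ; ends = λ { (inj₁ e) → pair inj₁ (ends G₁ (elt e))
             ; (inj₂ (inj₁ e)) → pair inj₂ (ends G₂ (elt e))
             ; (inj₂ (inj₂ (inj₁ _))) → (inj₁ u₁ , inj₂ u₂)
             ; (inj₂ (inj₂ (inj₂ _))) → (inj₁ v₁ , inj₂ v₂) } }

-- (G₁ , e₁ , u₁) ⊙_VE (G₂ , e₂ , u₂), where vᵢ is the other end of eᵢ: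
-- delete e₁, e₂, identify v₂ with v₁, add an edge u₁u₂
joinVE : (G₁ : Graph) → E G₁ → V G₁ → V G₁ →
         (G₂ : Graph) → DecidableEquality (V G₂) → E G₂ → V G₂ → V G₂ → Graph
joinVE G₁ e₁ u₁ v₁ G₂ dec e₂ u₂ v₂ = record
  { V = V G₁ ⊎ (V G₂ ∖ v₂)
  ; E = (E G₁ ∖ e₁) ⊎ ((E G₂ ∖ e₂) ⊎ ⊤)
  ; ends = λ { (inj₁ e) → pair inj₁ (ends G₁ (elt e))
             ; (inj₂ (inj₁ e)) → pair (glue dec v₂ v₁) (ends G₂ (elt e))
             ; (inj₂ (inj₂ _)) → (inj₁ u₁ , glue dec v₂ v₁ u₂) } }

module Submission where

-- For each operation, cycle decompositions D of the joined graph H correspond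
-- to pairs of decompositions D₁, D₂ of G₁, G₂ with |D₁| + |D₂| = k + |D|, where
-- k = 0 for ⊙_V and k = 1 otherwise (`SizeCorrespondence`); minimum and
-- maximum cycle numbers then transfer (`Transfer`).  For ⊙_V the glued vertex
-- cuts H, so every cycle lies in G₁ or in G₂.  For ⊙_E and ⊙_VE exactly one
-- cycle crosses between the sides through the new edges; cut open, it is a
-- path of G₁ - e₁ and a path of G₂ - e₂, which e₁ and e₂ close up to one cycle
-- each, and conversely.  Eulerianity only guarantees that decompositions
-- exist, which the hypotheses on c and ν already provide.

open import Defs
open import Data.Nat using (ℕ; zero; suc; _+_; _∸_; _≤_; s≤s; z≤n)
open import Data.Nat.Properties using (+-suc; +-mono-≤; ∸-monoˡ-≤; m+n∸m≡n)
open import Data.Fin using (Fin; zero; suc; inject₁; fromℕ)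
open import Data.Product using (Σ; ∃; _×_; _,_; proj₁; proj₂; swap)
open import Data.Product.Properties using (,-injectiveˡ; ,-injectiveʳ)
open import Data.Sum using (_⊎_; inj₁; inj₂) renaming (swap to ⊎-swap)
open import Data.Sum.Properties using (inj₁-injective; inj₂-injective; ≡-dec)
open import Data.Unit using (⊤; tt)
open import Data.Empty using (⊥; ⊥-elim; ⊥-elim-irr)
open import Function using (_∘_)
open import Relation.Nullary using (¬_; Dec; yes; no)
open import Relation.Binary.Definitions using (DecidableEquality)
open import Relation.Binary.PropositionalEquality
  using (_≡_; _≢_; refl; sym; trans; cong; cong₂; subst; subst₂; setoid; module ≡-Reasoning)
open import Data.List using (List; []; _∷_; _++_; [_]; map; length; lookup; reverse; tabulate)
open import Data.List.Properties
  using (++-assoc; unfold-reverse; length-tabulate; length-map; length-++; map-++; map-id; map-∘)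
open import Data.List.Relation.Unary.All using (All; []; _∷_)
import Data.List.Relation.Unary.All as All
import Data.List.Relation.Unary.All.Properties as All
open import Data.List.Relation.Unary.Any using (here; there; any?)
import Data.List.Relation.Unary.Any as Any
open import Data.List.Relation.Unary.Any.Properties using (lookup-index)
open import Data.List.Relation.Unary.AllPairs using ([]; _∷_)
open import Data.List.Relation.Unary.Unique.Propositional using (Unique)
open import Data.List.Relation.Unary.Unique.Propositional.Properties
  using (Unique[x∷xs]⇒x∉xs; ++⁺; tabulate⁺) renaming (map⁺ to unique-map⁺; map⁻ to unique-map⁻)
open import Data.List.Relation.Binary.Disjoint.Propositional using (Disjoint)
open import Data.List.Membership.Propositional using (_∈_; _∉_)
open import Data.List.Membership.Propositional.Properties
  using (∈-++⁺ˡ; ∈-++⁺ʳ; ∈-++⁻; ∈-map⁺; ∈-map⁻; ∈-lookup; ∈-tabulate⁺; ∈-tabulate⁻)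
open import Data.List.Relation.Binary.Permutation.Propositional
  using (_↭_; ↭-refl; ↭-prep; ↭-swap; ↭-trans; ↭-sym; ↭⇒↭ₛ; module PermutationReasoning)
open import Data.List.Relation.Binary.Permutation.Propositional.Properties
  using (∈-resp-↭; ↭-reverse; shift; shifts; ++-comm; ++⁺ˡ; ++⁺ʳ)
import Data.List.Relation.Binary.Permutation.Setoid.Properties as SetoidPerm

private
  variable
    A B : Set
    x : A
    xs ys : List A

unique-tail : Unique (x ∷ xs) → Unique xs
unique-tail (_ ∷ u) = u

unique-cons : x ∉ xs → Unique xs → Unique (x ∷ xs)
unique-cons x∉xs u = All.tabulate (λ y∈xs x≡y → x∉xs (subst (_∈ _) (sym x≡y) y∈xs)) ∷ u

unique-++ˡ : ∀ xs → Unique (xs ++ ys) → Unique xs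
unique-++ˡ []       u = []
unique-++ˡ (x ∷ xs) u =
  unique-cons (λ m → Unique[x∷xs]⇒x∉xs u (∈-++⁺ˡ m)) (unique-++ˡ xs (unique-tail u))

unique-++ʳ : ∀ xs → Unique (xs ++ ys) → Unique ys
unique-++ʳ []       u = u
unique-++ʳ (x ∷ xs) u = unique-++ʳ xs (unique-tail u)

unique-++-disjoint : ∀ xs → Unique (xs ++ ys) → Disjoint xs ys
unique-++-disjoint (x ∷ xs) u (here refl , m) = Unique[x∷xs]⇒x∉xs u (∈-++⁺ʳ xs m)
unique-++-disjoint (x ∷ xs) u (there p   , m) = unique-++-disjoint xs (unique-tail u) (p , m)

unique-resp-↭ : {A : Set} {xs ys : List A} → xs ↭ ys → Unique xs → Unique ys
unique-resp-↭ {A = A} p = SetoidPerm.Unique-resp-↭ (setoid A) (↭⇒↭ₛ p)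

∈-map-injective : {f : A → B} → (∀ {x y} → f x ≡ f y → x ≡ y) → f x ∈ map f xs → x ∈ xs
∈-map-injective inj m with ∈-map⁻ _ m
... | (z , z∈xs , eq) = subst (_∈ _) (sym (inj eq)) z∈xs

nonempty-++∷ : ∀ (xs : List A) {z : A} {zs : List A} → 1 ≤ length (xs ++ z ∷ zs)
nonempty-++∷ []      = s≤s z≤n
nonempty-++∷ (_ ∷ _) = s≤s z≤n

nonempty-++ : ∀ (xs ys : List A) → 1 ≤ length xs → 1 ≤ length (xs ++ ys)
nonempty-++ (_ ∷ _) ys _ = s≤s z≤n

lookup-injective : ∀ (xs : List A) → Unique xs → ∀ {i j} → lookup xs i ≡ lookup xs j → i ≡ j
lookup-injective (x ∷ xs) u {zero}  {zero}  eq = refl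
lookup-injective (x ∷ xs) u {zero}  {suc j} eq =
  ⊥-elim (Unique[x∷xs]⇒x∉xs u (subst (_∈ xs) (sym eq) (∈-lookup {xs = xs} j)))
lookup-injective (x ∷ xs) u {suc i} {zero}  eq = sym (lookup-injective (x ∷ xs) u (sym eq))
lookup-injective (x ∷ xs) u {suc i} {suc j} eq = cong suc (lookup-injective xs (unique-tail u) eq)

-- A cycle decomposition is exactly a list of cycles whose concatenated edge
-- lists are exact for the edge type; the lemmas below say how exactness
-- behaves under the type formers used by the graph operations.
Exact : (A : Set) → List A → Set
Exact A L = Unique L × (∀ a → a ∈ L)

exact-resp-↭ : {L L′ : List A} → L ↭ L′ → Exact A L → Exact A L′
exact-resp-↭ p (u , c) = unique-resp-↭ p u , λ a → ∈-resp-↭ p (c a)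

exact-⊤ : Exact ⊤ [ tt ]
exact-⊤ = ([] ∷ []) , λ { tt → here refl }

inj₁∉map-inj₂ : {a : A} (L : List B) → inj₁ a ∉ map inj₂ L
inj₁∉map-inj₂ (b ∷ L) (there m) = inj₁∉map-inj₂ L m

inj₂∉map-inj₁ : {b : B} (L : List A) → inj₂ b ∉ map inj₁ L
inj₂∉map-inj₁ (a ∷ L) (there m) = inj₂∉map-inj₁ L m

unique-⊎ : {L₁ : List A} {L₂ : List B} → Unique L₁ → Unique L₂ → Unique (map inj₁ L₁ ++ map inj₂ L₂)
unique-⊎ {L₁ = L₁} {L₂} u₁ u₂ = ++⁺ (unique-map⁺ inj₁-injective u₁) (unique-map⁺ inj₂-injective u₂) disjoint
  where
  disjoint : Disjoint (map inj₁ L₁) (map inj₂ L₂)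
  disjoint (m₁ , m₂) with ∈-map⁻ inj₁ m₁
  ... | (a , _ , refl) = inj₁∉map-inj₂ L₂ m₂

exact-⊎ : {L₁ : List A} {L₂ : List B} → Exact A L₁ → Exact B L₂ →
          Exact (A ⊎ B) (map inj₁ L₁ ++ map inj₂ L₂)
exact-⊎ {L₁ = L₁} {L₂} (u₁ , c₁) (u₂ , c₂) =
  unique-⊎ u₁ u₂ ,
  λ { (inj₁ a) → ∈-++⁺ˡ (∈-map⁺ inj₁ (c₁ a))
    ; (inj₂ b) → ∈-++⁺ʳ (map inj₁ L₁) (∈-map⁺ inj₂ (c₂ b)) }

exact-⊎⁻ : {L₁ : List A} {L₂ : List B} → Exact (A ⊎ B) (map inj₁ L₁ ++ map inj₂ L₂) →
           Exact A L₁ × Exact B L₂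
exact-⊎⁻ {L₁ = L₁} {L₂} (u , c) =
  (unique-map⁻ (unique-++ˡ (map inj₁ L₁) u) , λ a → ∈-map-injective inj₁-injective (left a)) ,
  (unique-map⁻ (unique-++ʳ (map inj₁ L₁) u) , λ b → ∈-map-injective inj₂-injective (right b))
  where
  left : ∀ a → inj₁ a ∈ map inj₁ L₁
  left a with ∈-++⁻ (map inj₁ L₁) (c (inj₁ a))
  ... | inj₁ m = m
  ... | inj₂ m = ⊥-elim (inj₁∉map-inj₂ L₂ m)
  right : ∀ b → inj₂ b ∈ map inj₂ L₂
  right b with ∈-++⁻ (map inj₁ L₁) (c (inj₂ b))
  ... | inj₁ m = ⊥-elim (inj₂∉map-inj₁ L₁ m)
  ... | inj₂ m = m

elt-injective : {a : A} {p q : A ∖ a} → elt p ≡ elt q → p ≡ q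
elt-injective {p = ⟨ x , _ ⟩} {⟨ .x , _ ⟩} refl = refl

removed∉map-elt : {a : A} (L : List (A ∖ a)) → a ∉ map elt L
removed∉map-elt (⟨ y , y≢a ⟩ ∷ L) (here a≡y) = ⊥-elim-irr (y≢a (sym a≡y))
removed∉map-elt (_ ∷ L)           (there m)  = removed∉map-elt L m

exact-∖ : {a : A} → DecidableEquality A → {L : List (A ∖ a)} → Exact (A ∖ a) L →
          Exact A (a ∷ map elt L)
exact-∖ {a = a} _≟_ {L} (u , c) =
  unique-cons (removed∉map-elt L) (unique-map⁺ elt-injective u) , covers
  where
  covers : ∀ b → b ∈ a ∷ map elt L
  covers b with b ≟ a
  ... | yes refl = here refl
  ... | no b≢a   = there (∈-map⁺ elt (c ⟨ b , b≢a ⟩))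

exact-∖⁻ : {a : A} {L : List (A ∖ a)} → Exact A (a ∷ map elt L) → Exact (A ∖ a) L
exact-∖⁻ {a = a} {L} (u , c) = unique-map⁻ (unique-tail u) , covers
  where
  covers : ∀ b → b ∈ L
  covers ⟨ b , b≢a ⟩ with c b
  ... | here b≡a = ⊥-elim-irr (b≢a b≡a)
  ... | there m  = ∈-map-injective elt-injective m

Joins-sym : {G : Graph} {e : E G} {x y : V G} → Joins G e x y → Joins G e y x
Joins-sym (inj₁ p) = inj₂ p
Joins-sym (inj₂ p) = inj₁ p

module _ {G : Graph} where

  data Walk : V G → V G → Set where
    nil  : ∀ {x} → Walk x x
    cons : ∀ {x y z} (e : E G) → Joins G e x y → Walk y z → Walk x z

  edges : ∀ {x y} → Walk x y → List (E G)
  edges nil          = []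
  edges (cons e _ w) = e ∷ edges w

  vertices : ∀ {x y} → Walk x y → List (V G)
  vertices {x} nil          = x ∷ []
  vertices {x} (cons _ _ w) = x ∷ vertices w

  sources : ∀ {x y} → Walk x y → List (V G)
  sources     nil          = []
  sources {x} (cons _ _ w) = x ∷ sources w

  vertices≡sources∷ʳ : ∀ {x y} (w : Walk x y) → vertices w ≡ sources w ++ [ y ]
  vertices≡sources∷ʳ nil              = refl
  vertices≡sources∷ʳ {x} (cons _ _ w) = cong (x ∷_) (vertices≡sources∷ʳ w)

  infixr 5 _++ᵂ_
  _++ᵂ_ : ∀ {x y z} → Walk x y → Walk y z → Walk x z
  nil        ++ᵂ v = v
  cons e j w ++ᵂ v = cons e j (w ++ᵂ v)

  edges-++ᵂ : ∀ {x y z} (w : Walk x y) (v : Walk y z) → edges (w ++ᵂ v) ≡ edges w ++ edges v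
  edges-++ᵂ nil          v = refl
  edges-++ᵂ (cons e _ w) v = cong (e ∷_) (edges-++ᵂ w v)

  vertices-++ᵂ : ∀ {x y z} (w : Walk x y) (v : Walk y z) →
                 vertices (w ++ᵂ v) ≡ sources w ++ vertices v
  vertices-++ᵂ nil              v = refl
  vertices-++ᵂ {x} (cons _ _ w) v = cong (x ∷_) (vertices-++ᵂ w v)

  reverseᵂ : ∀ {x y} → Walk x y → Walk y x
  reverseᵂ nil          = nil
  reverseᵂ (cons e j w) = reverseᵂ w ++ᵂ cons e (Joins-sym {G} j) nil

  edges-reverseᵂ : ∀ {x y} (w : Walk x y) → edges (reverseᵂ w) ≡ reverse (edges w)
  edges-reverseᵂ nil          = refl
  edges-reverseᵂ (cons e j w) = begin
    edges (reverseᵂ w ++ᵂ cons e (Joins-sym {G} j) nil) ≡⟨ edges-++ᵂ (reverseᵂ w) _ ⟩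
    edges (reverseᵂ w) ++ [ e ]                     ≡⟨ cong (_++ [ e ]) (edges-reverseᵂ w) ⟩
    reverse (edges w) ++ [ e ]                      ≡⟨ unfold-reverse e (edges w) ⟨
    reverse (e ∷ edges w)                           ∎
    where open ≡-Reasoning

  vertices-reverseᵂ : ∀ {x y} (w : Walk x y) → vertices (reverseᵂ w) ≡ reverse (vertices w)
  vertices-reverseᵂ nil = refl
  vertices-reverseᵂ {x} (cons {y = m} e j w) = begin
    vertices (reverseᵂ w ++ᵂ cons e (Joins-sym {G} j) nil) ≡⟨ vertices-++ᵂ (reverseᵂ w) _ ⟩
    sources (reverseᵂ w) ++ [ m ] ++ [ x ]              ≡⟨ ++-assoc (sources (reverseᵂ w)) [ m ] [ x ] ⟨
    (sources (reverseᵂ w) ++ [ m ]) ++ [ x ]            ≡⟨ cong (_++ [ x ]) (vertices≡sources∷ʳ (reverseᵂ w)) ⟨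
    vertices (reverseᵂ w) ++ [ x ]                      ≡⟨ cong (_++ [ x ]) (vertices-reverseᵂ w) ⟩
    reverse (vertices w) ++ [ x ]                       ≡⟨ unfold-reverse x (vertices w) ⟨
    reverse (x ∷ vertices w)                            ∎
    where open ≡-Reasoning

  castᵂ : ∀ {x x′ y y′} → x ≡ x′ → y ≡ y′ → Walk x y → Walk x′ y′
  castᵂ refl refl w = w

  edges-castᵂ : ∀ {x x′ y y′} (p : x ≡ x′) (q : y ≡ y′) (w : Walk x y) → edges (castᵂ p q w) ≡ edges w
  edges-castᵂ refl refl w = refl

  vertices-castᵂ : ∀ {x x′ y y′} (p : x ≡ x′) (q : y ≡ y′) (w : Walk x y) →
                   vertices (castᵂ p q w) ≡ vertices w
  vertices-castᵂ refl refl w = refl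

  record EdgeSplit {x y : V G} (w : Walk x y) (f : E G) : Set where
    field
      {m m′}   : V G
      before   : Walk x m
      f-joins  : Joins G f m m′
      after    : Walk m′ y
      edges≡   : edges w ≡ edges before ++ f ∷ edges after
      vertices≡ : vertices w ≡ vertices before ++ vertices after

  splitAtEdge : ∀ {x y f} (w : Walk x y) → f ∈ edges w → EdgeSplit w f
  splitAtEdge (cons e j w) (here refl) =
    record { before = nil ; f-joins = j ; after = w ; edges≡ = refl ; vertices≡ = refl }
  splitAtEdge {x} (cons e j w) (there p) = record
    { before = cons e j before ; f-joins = f-joins ; after = after
    ; edges≡ = cong (e ∷_) edges≡ ; vertices≡ = cong (x ∷_) vertices≡ }
    where open EdgeSplit (splitAtEdge w p)

  record VertexSplit {x y : V G} (w : Walk x y) (v : V G) : Set where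
    field
      before    : Walk x v
      after     : Walk v y
      edges≡    : edges w ≡ edges before ++ edges after
      vertices≡ : vertices w ≡ sources before ++ vertices after

  splitAtVertex : ∀ {x y v} (w : Walk x y) → v ∈ vertices w → VertexSplit w v
  splitAtVertex nil (here refl) =
    record { before = nil ; after = nil ; edges≡ = refl ; vertices≡ = refl }
  splitAtVertex (cons e j w) (here refl) =
    record { before = nil ; after = cons e j w ; edges≡ = refl ; vertices≡ = refl }
  splitAtVertex {x} (cons e j w) (there p) = record
    { before = cons e j before ; after = after
    ; edges≡ = cong (e ∷_) edges≡ ; vertices≡ = cong (x ∷_) vertices≡ }
    where open VertexSplit (splitAtVertex w p)

pair-injective : {a b c d : A} → (a , b) ≡ (c , d) → a ≡ c × b ≡ d
pair-injective p = ,-injectiveˡ p , ,-injectiveʳ p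

targets : {G : Graph} {x y : V G} → Walk {G} x y → List (V G)
targets nil          = []
targets (cons _ _ w) = vertices w

vertices≡∷targets : {G : Graph} {x y : V G} (w : Walk {G} x y) → vertices w ≡ x ∷ targets w
vertices≡∷targets nil          = refl
vertices≡∷targets (cons _ _ w) = refl

sources⊆vertices : {G : Graph} {x y : V G} (w : Walk {G} x y) {v : V G} → v ∈ sources w → v ∈ vertices w
sources⊆vertices (cons _ _ w) (here p)  = here p
sources⊆vertices (cons _ _ w) (there m) = there (sources⊆vertices w m)

split-avoids : {G : Graph} {x y v : V G} (w : Walk {G} x y) → Unique (vertices w) → (s : VertexSplit w v) →
               (∀ {u} → u ∈ sources (VertexSplit.before s) → u ≢ v) ×
               (∀ {u} → u ∈ targets (VertexSplit.after s) → u ≢ v)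
split-avoids w uV s = avoid-before , avoid-after
  where
  open VertexSplit s
  unique′ : Unique (sources before ++ vertices after)
  unique′ = subst Unique vertices≡ uV
  avoid-before : ∀ {u} → u ∈ sources before → u ≢ _
  avoid-before u∈ refl = unique-++-disjoint (sources before) unique′
                           (u∈ , subst (_ ∈_) (sym (vertices≡∷targets after)) (here refl))
  avoid-after : ∀ {u} → u ∈ targets after → u ≢ _
  avoid-after u∈ refl = Unique[x∷xs]⇒x∉xs
    (subst Unique (vertices≡∷targets after) (unique-++ʳ (sources before) unique′)) u∈

joins-agree : {G : Graph} {e : E G} {a b c d : V G} →
              Joins G e a b → Joins G e c d → (c ≡ a × d ≡ b) ⊎ (c ≡ b × d ≡ a)
joins-agree (inj₁ p) (inj₁ q) = inj₁ (pair-injective (trans (sym q) p))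
joins-agree (inj₁ p) (inj₂ q) = inj₂ (swap (pair-injective (trans (sym q) p)))
joins-agree (inj₂ p) (inj₁ q) = inj₂ (pair-injective (trans (sym q) p))
joins-agree (inj₂ p) (inj₂ q) = inj₁ (swap (pair-injective (trans (sym q) p)))

-- Cycles, represented as a path closed up by one more edge.  This is the
-- list-based counterpart of `Cycle`, convenient for cutting and gluing.
module _ {G : Graph} where

  record CycleWalk : Set where
    constructor mkCycleWalk
    field
      {start end}     : V G
      closing         : E G
      closing-joins   : Joins G closing end start
      path            : Walk {G} start end
      nonempty        : 1 ≤ length (edges path)
      vertices-unique : Unique (vertices path)
      edges-unique    : Unique (closing ∷ edges path)

  open CycleWalk

  cycleEdges : CycleWalk → List (E G)
  cycleEdges C = closing C ∷ edges (path C)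

  record Oriented (e : E G) (u v : V G) (C : CycleWalk) : Set where
    field
      walk            : Walk {G} u v
      vertices-unique : Unique (vertices walk)
      edges-unique    : Unique (e ∷ edges walk)
      edges↭          : cycleEdges C ↭ e ∷ edges walk

  orient : ∀ {e u v} (C : CycleWalk) → closing C ≡ e → Joins G e u v → Oriented e u v C
  orient C refl J with joins-agree {G} (closing-joins C) J
  ... | inj₂ (refl , refl) = record
    { walk = path C ; vertices-unique = vertices-unique C ; edges-unique = edges-unique C
    ; edges↭ = ↭-refl }
  ... | inj₁ (refl , refl) = record
    { walk = reverseᵂ (path C)
    ; vertices-unique = subst Unique (sym (vertices-reverseᵂ (path C)))
                          (unique-resp-↭ (↭-sym (↭-reverse (vertices (path C)))) (vertices-unique C))
    ; edges-unique = subst Unique (sym edges≡) (unique-resp-↭ (↭-prep _ reversal) (edges-unique C))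
    ; edges↭ = subst (λ l → cycleEdges C ↭ closing C ∷ l) (sym (edges-reverseᵂ (path C)))
                 (↭-prep _ reversal) }
    where
    reversal : edges (path C) ↭ reverse (edges (path C))
    reversal = ↭-sym (↭-reverse (edges (path C)))
    edges≡ : closing C ∷ edges (reverseᵂ (path C)) ≡ closing C ∷ reverse (edges (path C))
    edges≡ = cong (closing C ∷_) (edges-reverseᵂ (path C))

  rotate : (C : CycleWalk) {f : E G} → f ∈ cycleEdges C →
           Σ CycleWalk λ C′ → (closing C′ ≡ f) × (cycleEdges C′ ↭ cycleEdges C)
  rotate C (here refl) = C , refl , ↭-refl
  rotate (mkCycleWalk {x} {y} e j P _ uV uE) {f} (there f∈P) =
    mkCycleWalk f f-joins P′ nonempty′ (subst Unique (sym vertices≡′) unique′) (unique-resp-↭ edges↭ uE) ,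
    refl , ↭-sym edges↭
    where
    split : EdgeSplit {G} {x} {y} P f
    split = splitAtEdge P f∈P
    open EdgeSplit split
    P′ : Walk {G} m′ m
    P′ = after ++ᵂ cons e j before
    edges≡′ : edges P′ ≡ edges after ++ e ∷ edges before
    edges≡′ = edges-++ᵂ after (cons e j before)
    vertices≡′ : vertices P′ ≡ vertices after ++ vertices before
    vertices≡′ = begin
      vertices P′                                  ≡⟨ vertices-++ᵂ after (cons e j before) ⟩
      sources after ++ [ y ] ++ vertices before    ≡⟨ ++-assoc (sources after) [ y ] _ ⟨
      (sources after ++ [ y ]) ++ vertices before  ≡⟨ cong (_++ vertices before) (vertices≡sources∷ʳ after) ⟨
      vertices after ++ vertices before            ∎
      where open ≡-Reasoning
    unique′ : Unique (vertices after ++ vertices before)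
    unique′ = unique-resp-↭ (++-comm (vertices before) (vertices after)) (subst Unique vertices≡ uV)
    nonempty′ : 1 ≤ length (edges P′)
    nonempty′ = subst (λ l → 1 ≤ length l) (sym edges≡′) (nonempty-++∷ (edges after))
    edges↭ : e ∷ edges P ↭ f ∷ edges P′
    edges↭ = begin
      e ∷ edges P                                ≡⟨ cong (e ∷_) edges≡ ⟩
      e ∷ edges before ++ f ∷ edges after        ↭⟨ ↭-prep e (shift f (edges before) (edges after)) ⟩
      e ∷ f ∷ edges before ++ edges after        ↭⟨ ↭-swap e f ↭-refl ⟩
      f ∷ (e ∷ edges before) ++ edges after      ↭⟨ ↭-prep f (++-comm (e ∷ edges before) (edges after)) ⟩
      f ∷ edges after ++ e ∷ edges before        ≡⟨ cong (f ∷_) edges≡′ ⟨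
      f ∷ edges P′                               ∎
      where open PermutationReasoning

  allEdges : List CycleWalk → List (E G)
  allEdges []       = []
  allEdges (C ∷ cs) = cycleEdges C ++ allEdges cs

  allEdges-++ : (cs ds : List CycleWalk) → allEdges (cs ++ ds) ≡ allEdges cs ++ allEdges ds
  allEdges-++ []       ds = refl
  allEdges-++ (C ∷ cs) ds = trans (cong (cycleEdges C ++_) (allEdges-++ cs ds))
                                  (sym (++-assoc (cycleEdges C) (allEdges cs) (allEdges ds)))

  record Decomposition : Set where
    field
      cycles : List CycleWalk
      exact  : Exact (E G) (allEdges cycles)

  size : Decomposition → ℕ
  size D = length (Decomposition.cycles D)

  record Extraction (cs : List CycleWalk) (f : E G) : Set where
    field
      cycle      : CycleWalk
      closes-f   : closing cycle ≡ f
      rest       : List CycleWalk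
      edges↭     : allEdges cs ↭ cycleEdges cycle ++ allEdges rest
      length≡    : length cs ≡ suc (length rest)

  extract : (cs : List CycleWalk) {f : E G} → f ∈ allEdges cs → Extraction cs f
  extract (C ∷ cs) m with ∈-++⁻ (cycleEdges C) m
  ... | inj₁ f∈C = let (C′ , closes , C′↭C) = rotate C f∈C in record
    { cycle = C′ ; closes-f = closes ; rest = cs
    ; edges↭ = ++⁺ʳ (allEdges cs) (↭-sym C′↭C) ; length≡ = refl }
  ... | inj₂ f∈cs = record
    { cycle = cycle ; closes-f = closes-f ; rest = C ∷ rest
    ; edges↭ = ↭-trans (++⁺ˡ (cycleEdges C) edges↭) (shifts (cycleEdges C) (cycleEdges cycle))
    ; length≡ = cong suc length≡ }
    where open Extraction (extract cs f∈cs)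

module _ {G : Graph} where

  indexedWalk : (k : ℕ) (us : Fin (suc k) → V G) (ps : Fin k → E G) →
                (∀ i → Joins G (ps i) (us (inject₁ i)) (us (suc i))) →
                Walk {G} (us zero) (us (fromℕ k))
  indexedWalk zero    us ps js = nil
  indexedWalk (suc k) us ps js =
    cons (ps zero) (js zero) (indexedWalk k (us ∘ suc) (ps ∘ suc) (js ∘ suc))

  edges-indexedWalk : ∀ k us ps js → edges (indexedWalk k us ps js) ≡ tabulate ps
  edges-indexedWalk zero    us ps js = refl
  edges-indexedWalk (suc k) us ps js =
    cong (ps zero ∷_) (edges-indexedWalk k (us ∘ suc) (ps ∘ suc) (js ∘ suc))

  vertices-indexedWalk : ∀ k us ps js → vertices (indexedWalk k us ps js) ≡ tabulate us
  vertices-indexedWalk zero    us ps js = refl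
  vertices-indexedWalk (suc k) us ps js =
    cong (us zero ∷_) (vertices-indexedWalk k (us ∘ suc) (ps ∘ suc) (js ∘ suc))

  toCycleWalk : Cycle G → CycleWalk {G}
  toCycleWalk C = mkCycleWalk closeEdge closeJoins W
    (subst (λ l → 1 ≤ length l) (sym edges≡) (subst (1 ≤_) (sym (length-tabulate pathEdge)) k≥1))
    (subst Unique (sym (vertices-indexedWalk k verts pathEdge pathJoins)) (tabulate⁺ vertsInj))
    (subst (λ l → Unique (closeEdge ∷ l)) (sym edges≡) (tabulate⁺ edgesInj))
    where
    open Cycle C
    W : Walk {G} (verts zero) (verts (fromℕ k))
    W = indexedWalk k verts pathEdge pathJoins
    edges≡ : edges W ≡ tabulate pathEdge
    edges≡ = edges-indexedWalk k verts pathEdge pathJoins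

  cycleEdges-toCycleWalk : (C : Cycle G) → cycleEdges (toCycleWalk C) ≡ tabulate (cedges C)
  cycleEdges-toCycleWalk C = cong (Cycle.closeEdge C ∷_)
    (edges-indexedWalk (Cycle.k C) (Cycle.verts C) (Cycle.pathEdge C) (Cycle.pathJoins C))

  vertexAt : ∀ {x y} (w : Walk {G} x y) → Fin (suc (length (edges w))) → V G
  vertexAt {x} nil          zero    = x
  vertexAt {x} (cons _ _ w) zero    = x
  vertexAt     (cons _ _ w) (suc i) = vertexAt w i

  vertexAt-first : ∀ {x y} (w : Walk {G} x y) → vertexAt w zero ≡ x
  vertexAt-first nil          = refl
  vertexAt-first (cons _ _ w) = refl

  vertexAt-last : ∀ {x y} (w : Walk {G} x y) → vertexAt w (fromℕ (length (edges w))) ≡ y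
  vertexAt-last nil          = refl
  vertexAt-last (cons _ _ w) = vertexAt-last w

  vertexAt-joins : ∀ {x y} (w : Walk {G} x y) (i : Fin (length (edges w))) →
                   Joins G (lookup (edges w) i) (vertexAt w (inject₁ i)) (vertexAt w (suc i))
  vertexAt-joins (cons e j w) zero    = subst (Joins G e _) (sym (vertexAt-first w)) j
  vertexAt-joins (cons e j w) (suc i) = vertexAt-joins w i

  vertexAt-∈ : ∀ {x y} (w : Walk {G} x y) i → vertexAt w i ∈ vertices w
  vertexAt-∈ nil          zero    = here refl
  vertexAt-∈ (cons _ _ w) zero    = here refl
  vertexAt-∈ (cons _ _ w) (suc i) = there (vertexAt-∈ w i)

  vertexAt-injective : ∀ {x y} (w : Walk {G} x y) → Unique (vertices w) →
                       ∀ {i i′} → vertexAt w i ≡ vertexAt w i′ → i ≡ i′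
  vertexAt-injective nil          u {zero}  {zero}   eq = refl
  vertexAt-injective (cons _ _ w) u {zero}  {zero}   eq = refl
  vertexAt-injective (cons _ _ w) u {zero}  {suc i′} eq =
    ⊥-elim (Unique[x∷xs]⇒x∉xs u (subst (_∈ vertices w) (sym eq) (vertexAt-∈ w i′)))
  vertexAt-injective (cons _ _ w) u {suc i} {zero}   eq =
    ⊥-elim (Unique[x∷xs]⇒x∉xs u (subst (_∈ vertices w) eq (vertexAt-∈ w i)))
  vertexAt-injective (cons _ _ w) u {suc i} {suc i′} eq =
    cong suc (vertexAt-injective w (unique-tail u) eq)

  fromCycleWalk : CycleWalk {G} → Cycle G
  fromCycleWalk (mkCycleWalk e j P ne uV uE) = record
    { k          = length (edges P)
    ; k≥1        = ne
    ; verts      = vertexAt P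
    ; vertsInj   = vertexAt-injective P uV
    ; pathEdge   = lookup (edges P)
    ; pathJoins  = vertexAt-joins P
    ; closeEdge  = e
    ; closeJoins = subst₂ (Joins G e) (sym (vertexAt-last P)) (sym (vertexAt-first P)) j
    ; edgesInj   = λ {i} {i′} eq →
        lookup-injective (e ∷ edges P) uE (trans (lookup-cons i) (trans eq (sym (lookup-cons i′))))
    }
    where
    lookup-cons : ∀ i → lookup (e ∷ edges P) i ≡ consFin e (lookup (edges P)) i
    lookup-cons zero    = refl
    lookup-cons (suc i) = refl

  cedges-fromCycleWalk : (C : CycleWalk {G}) (i : Fin (length (cycleEdges C))) →
                         cedges (fromCycleWalk C) i ≡ lookup (cycleEdges C) i
  cedges-fromCycleWalk (mkCycleWalk _ _ _ _ _ _) zero    = refl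
  cedges-fromCycleWalk (mkCycleWalk _ _ _ _ _ _) (suc i) = refl

Index : (m : ℕ) → (Fin m → ℕ) → Set
Index m n = Σ (Fin m) λ j → Fin (n j)

module _ {A : Set} where

  flatten : (m : ℕ) (n : Fin m → ℕ) → (Index m n → A) → List A
  flatten zero    n F = []
  flatten (suc m) n F = tabulate (λ i → F (zero , i)) ++ flatten m (n ∘ suc) (λ (j , i) → F (suc j , i))

  flatten-∈ : ∀ m n F p → F p ∈ flatten m n F
  flatten-∈ (suc m) n F (zero  , i) = ∈-++⁺ˡ (∈-tabulate⁺ i)
  flatten-∈ (suc m) n F (suc j , i) = ∈-++⁺ʳ _ (flatten-∈ m (n ∘ suc) _ (j , i))

  flatten-∈⁻ : ∀ m n F {a} → a ∈ flatten m n F → ∃ λ p → a ≡ F p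
  flatten-∈⁻ (suc m) n F mem with ∈-++⁻ (tabulate (λ i → F (zero , i))) mem
  ... | inj₁ q = let (i , eq) = ∈-tabulate⁻ q in (zero , i) , eq
  ... | inj₂ q = let ((j , i) , eq) = flatten-∈⁻ m (n ∘ suc) _ q in (suc j , i) , eq

  flatten-unique : ∀ m n F → (∀ {p q} → F p ≡ F q → p ≡ q) → Unique (flatten m n F)
  flatten-unique zero    n F inj = []
  flatten-unique (suc m) n F inj =
    ++⁺ (tabulate⁺ λ eq → first-injective (inj eq))
        (flatten-unique m (n ∘ suc) _ λ eq → later-injective (inj eq))
        disjoint
    where
    first-injective : ∀ {i i′} → _≡_ {A = Index (suc m) n} (zero , i) (zero , i′) → i ≡ i′
    first-injective refl = refl
    later-injective : ∀ {j j′ i i′} → _≡_ {A = Index (suc m) n} (suc j , i) (suc j′ , i′) →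
                      _≡_ {A = Index m (n ∘ suc)} (j , i) (j′ , i′)
    later-injective refl = refl
    zero≢suc : ∀ {i j i′} → _≡_ {A = Index (suc m) n} (zero , i) (suc j , i′) → ⊥
    zero≢suc ()
    disjoint : Disjoint (tabulate (λ i → F (zero , i))) (flatten m (n ∘ suc) (λ (j , i) → F (suc j , i)))
    disjoint (m₁ , m₂) with ∈-tabulate⁻ m₁ | flatten-∈⁻ m (n ∘ suc) _ m₂
    ... | (i , e₁) | ((j , i′) , e₂) = zero≢suc (inj (trans (sym e₁) e₂))

module _ {G : Graph} where

  allEdges-tabulate : ∀ m (g : Fin m → CycleWalk {G}) n F →
                      (∀ j → cycleEdges (g j) ≡ tabulate (λ i → F (j , i))) →
                      allEdges (tabulate g) ≡ flatten m n F
  allEdges-tabulate zero    g n F h = refl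
  allEdges-tabulate (suc m) g n F h =
    cong₂ _++_ (h zero) (allEdges-tabulate m (g ∘ suc) (n ∘ suc) _ (h ∘ suc))

  toDecomposition : (D : CycleDecomposition G) → Σ (Decomposition {G}) λ L → size L ≡ count D
  toDecomposition D =
    record { cycles = tabulate (toCycleWalk ∘ cycles)
           ; exact  = subst (Exact (E G)) (sym edges≡)
                        ( flatten-unique m n F (proj₁ exact)
                        , λ e → let (p , h) = proj₂ exact e in subst (_∈ _) (h refl) (flatten-∈ m n F p)) } ,
    length-tabulate _
    where
    open CycleDecomposition D hiding (count)
    m : ℕ
    m = CycleDecomposition.count D
    n : Fin m → ℕ
    n j = suc (Cycle.k (cycles j))
    F : Index m n → E G
    F (j , i) = cedges (cycles j) i
    edges≡ : allEdges (tabulate (toCycleWalk ∘ cycles)) ≡ flatten m n F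
    edges≡ = allEdges-tabulate m _ n F (λ j → cycleEdges-toCycleWalk (cycles j))

  edgeAt : (cs : List (CycleWalk {G})) → Σ (Fin (length cs)) (λ j → Fin (length (cycleEdges (lookup cs j)))) → E G
  edgeAt cs (j , i) = lookup (cycleEdges (lookup cs j)) i

  edgeAt-∈ : (cs : List (CycleWalk {G})) → ∀ p → edgeAt cs p ∈ allEdges cs
  edgeAt-∈ (C ∷ cs) (zero  , i) = ∈-++⁺ˡ (∈-lookup {xs = cycleEdges C} i)
  edgeAt-∈ (C ∷ cs) (suc j , i) = ∈-++⁺ʳ (cycleEdges C) (edgeAt-∈ cs (j , i))

  edgeAt-injective : (cs : List (CycleWalk {G})) → Unique (allEdges cs) →
                     ∀ {p q} → edgeAt cs p ≡ edgeAt cs q → p ≡ q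
  edgeAt-injective (C ∷ cs) u {zero , i} {zero , i′} eq
    with lookup-injective (cycleEdges C) (unique-++ˡ (cycleEdges C) u) {i} {i′} eq
  ... | refl = refl
  edgeAt-injective (C ∷ cs) u {zero , i} {suc j′ , i′} eq =
    ⊥-elim (unique-++-disjoint (cycleEdges C) u
              (∈-lookup {xs = cycleEdges C} i , subst (_∈ _) (sym eq) (edgeAt-∈ cs (j′ , i′))))
  edgeAt-injective (C ∷ cs) u {suc j , i} {zero , i′} eq =
    ⊥-elim (unique-++-disjoint (cycleEdges C) u
              (∈-lookup {xs = cycleEdges C} i′ , subst (_∈ _) eq (edgeAt-∈ cs (j , i))))
  edgeAt-injective (C ∷ cs) u {suc j , i} {suc j′ , i′} eq
    with edgeAt-injective cs (unique-++ʳ (cycleEdges C) u) {j , i} {j′ , i′} eq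
  ... | refl = refl

  edgeAt-surjective : (cs : List (CycleWalk {G})) {e : E G} → e ∈ allEdges cs → ∃ λ p → edgeAt cs p ≡ e
  edgeAt-surjective (C ∷ cs) m with ∈-++⁻ (cycleEdges C) m
  ... | inj₁ q = (zero , Any.index q) , sym (lookup-index q)
  ... | inj₂ q = let ((j , i) , eq) = edgeAt-surjective cs q in (suc j , i) , eq

  fromDecomposition : (L : Decomposition {G}) → Σ (CycleDecomposition G) λ D → count D ≡ size L
  fromDecomposition L =
    record { count  = length cycles
           ; cycles = λ j → fromCycleWalk (lookup cycles j)
           ; exact  = (λ {p} {q} eq → edgeAt-injective cycles (proj₁ exact)
                                          (trans (sym (edge≡ p)) (trans eq (edge≡ q))))
                    , λ e → let (p , h) = edgeAt-surjective cycles (proj₂ exact e) in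
                            p , λ { refl → trans (edge≡ p) h } } ,
    refl
    where
    open Decomposition L
    edge≡ : ∀ p → cedges (fromCycleWalk (lookup cycles (proj₁ p))) (proj₂ p) ≡ edgeAt cycles p
    edge≡ (j , i) = cedges-fromCycleWalk (lookup cycles j) i

record Embedding (G H : Graph) : Set where
  field
    vertex           : V G → V H
    edge             : E G → E H
    vertex-injective : ∀ {a b} → vertex a ≡ vertex b → a ≡ b
    edge-injective   : ∀ {a b} → edge a ≡ edge b → a ≡ b
    ends-commute     : ∀ e → ends H (edge e) ≡ pair vertex (ends G e)

module EmbeddingProperties {G H : Graph} (M : Embedding G H) where
  open Embedding M

  push-joins : ∀ {e x y} → Joins G e x y → Joins H (edge e) (vertex x) (vertex y)
  push-joins {e} (inj₁ p) = inj₁ (trans (ends-commute e) (cong (pair vertex) p))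
  push-joins {e} (inj₂ p) = inj₂ (trans (ends-commute e) (cong (pair vertex) p))

  pushWalk : ∀ {x y} → Walk {G} x y → Walk {H} (vertex x) (vertex y)
  pushWalk nil          = nil
  pushWalk (cons e j w) = cons (edge e) (push-joins j) (pushWalk w)

  edges-pushWalk : ∀ {x y} (w : Walk {G} x y) → edges (pushWalk w) ≡ map edge (edges w)
  edges-pushWalk nil          = refl
  edges-pushWalk (cons e j w) = cong (edge e ∷_) (edges-pushWalk w)

  vertices-pushWalk : ∀ {x y} (w : Walk {G} x y) → vertices (pushWalk w) ≡ map vertex (vertices w)
  vertices-pushWalk nil              = refl
  vertices-pushWalk {x} (cons e j w) = cong (vertex x ∷_) (vertices-pushWalk w)

  sources-pushWalk : ∀ {x y} (w : Walk {G} x y) → sources (pushWalk w) ≡ map vertex (sources w)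
  sources-pushWalk nil              = refl
  sources-pushWalk {x} (cons e j w) = cong (vertex x ∷_) (sources-pushWalk w)

  pushCycle : CycleWalk {G} → CycleWalk {H}
  pushCycle (mkCycleWalk e j P ne uV uE) =
    mkCycleWalk (edge e) (push-joins j) (pushWalk P)
      (subst (λ l → 1 ≤ length l) (sym edges≡) (subst (1 ≤_) (sym (length-map edge (edges P))) ne))
      (subst Unique (sym (vertices-pushWalk P)) (unique-map⁺ vertex-injective uV))
      (subst (λ l → Unique (edge e ∷ l)) (sym edges≡) (unique-map⁺ edge-injective uE))
    where
    edges≡ : edges (pushWalk P) ≡ map edge (edges P)
    edges≡ = edges-pushWalk P

  cycleEdges-pushCycle : (C : CycleWalk {G}) → cycleEdges (pushCycle C) ≡ map edge (cycleEdges C)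
  cycleEdges-pushCycle (mkCycleWalk e _ P _ _ _) = cong (edge e ∷_) (edges-pushWalk P)

  allEdges-pushCycles : (cs : List (CycleWalk {G})) → allEdges (map pushCycle cs) ≡ map edge (allEdges cs)
  allEdges-pushCycles []       = refl
  allEdges-pushCycles (C ∷ cs) =
    trans (cong₂ _++_ (cycleEdges-pushCycle C) (allEdges-pushCycles cs))
          (sym (map-++ edge (cycleEdges C) (allEdges cs)))

  InImage : E H → Set
  InImage e = ∃ λ e′ → edge e′ ≡ e

  ends-in-image : ∀ {e′ a b} → Joins H (edge e′) a b → (∃ λ a′ → vertex a′ ≡ a) × (∃ λ b′ → vertex b′ ≡ b)
  ends-in-image {e′} j with ends G e′ | ends-commute e′
  ... | (u , v) | commute with j
  ...   | inj₁ p = (u , ,-injectiveˡ eq) , (v , ,-injectiveʳ eq) where eq = trans (sym commute) p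
  ...   | inj₂ p = (v , ,-injectiveʳ eq) , (u , ,-injectiveˡ eq) where eq = trans (sym commute) p

  pull-joins : ∀ {e′ x m} → Joins H (edge e′) (vertex x) m → Σ (V G) λ y → (vertex y ≡ m) × Joins G e′ x y
  pull-joins {e′} j with ends G e′ | ends-commute e′
  ... | (u , v) | commute with j
  ...   | inj₁ p with vertex-injective (,-injectiveˡ (trans (sym commute) p))
  ...     | refl = v , ,-injectiveʳ (trans (sym commute) p) , inj₁ refl
  pull-joins {e′} j | (u , v) | commute | inj₂ p with vertex-injective (,-injectiveʳ (trans (sym commute) p))
  ...     | refl = u , ,-injectiveˡ (trans (sym commute) p) , inj₂ refl

  record PulledWalk {a b : V H} (w : Walk {H} a b) (x : V G) : Set where
    field
      {y}       : V G
      walk      : Walk {G} x y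
      end≡      : vertex y ≡ b
      edges≡    : map edge (edges walk) ≡ edges w
      vertices≡ : map vertex (vertices walk) ≡ vertices w

  pullWalk : ∀ {a b} (w : Walk {H} a b) {x} → vertex x ≡ a → All InImage (edges w) → PulledWalk w x
  pullWalk nil refl [] = record { walk = nil ; end≡ = refl ; edges≡ = refl ; vertices≡ = refl }
  pullWalk (cons e j w) refl ((e′ , refl) ∷ im) with pull-joins j
  ... | (y , y≡ , j′) = record
    { walk = cons e′ j′ walk ; end≡ = end≡
    ; edges≡ = cong (edge e′ ∷_) edges≡ ; vertices≡ = cong (vertex _ ∷_) vertices≡ }
    where open PulledWalk (pullWalk w y≡ im)

  pullCycle : (C : CycleWalk {H}) → All InImage (cycleEdges C) →
              Σ (CycleWalk {G}) λ C′ → map edge (cycleEdges C′) ≡ cycleEdges C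
  pullCycle (mkCycleWalk {x} e j P ne uV uE) ((e′ , refl) ∷ im)
    with proj₂ (ends-in-image j)
  ... | (x′ , x′≡) with pullWalk P x′≡ im
  ... | pulled with pull-joins (subst (λ z → Joins H (edge e′) z x) (sym (PulledWalk.end≡ pulled)) j)
  ... | (z , z≡ , j′) with vertex-injective (trans z≡ (sym x′≡))
  ... | refl =
    mkCycleWalk e′ j′ walk
      (subst (1 ≤_) (trans (cong length (sym edges≡)) (length-map edge (edges walk))) ne)
      (unique-map⁻ (subst Unique (sym vertices≡) uV))
      (unique-map⁻ {f = edge} (subst (λ l → Unique (edge e′ ∷ l)) (sym edges≡) uE)) ,
    cong (edge e′ ∷_) edges≡
    where open PulledWalk pulled

module TwoEmbeddings {G₁ G₂ H : Graph} (M₁ : Embedding G₁ H) (M₂ : Embedding G₂ H) where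
  module P₁ = EmbeddingProperties M₁
  module P₂ = EmbeddingProperties M₂
  open Embedding M₁ using () renaming (edge to edge₁)
  open Embedding M₂ using () renaming (edge to edge₂)

  OnOneSide : CycleWalk {H} → Set
  OnOneSide C = All P₁.InImage (cycleEdges C) ⊎ All P₂.InImage (cycleEdges C)

  record Separated (cs : List (CycleWalk {H})) : Set where
    field
      cycles₁ : List (CycleWalk {G₁})
      cycles₂ : List (CycleWalk {G₂})
      edges↭  : allEdges cs ↭ map edge₁ (allEdges cycles₁) ++ map edge₂ (allEdges cycles₂)
      length≡ : length cs ≡ length cycles₁ + length cycles₂

  separate : (cs : List (CycleWalk {H})) → All OnOneSide cs → Separated cs
  separate [] [] = record { cycles₁ = [] ; cycles₂ = [] ; edges↭ = ↭-refl ; length≡ = refl }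
  separate (C ∷ cs) (inj₁ inG₁ ∷ sides) with P₁.pullCycle C inG₁
  ... | (C′ , C≡) = record
    { cycles₁ = C′ ∷ cycles₁ ; cycles₂ = cycles₂ ; length≡ = cong suc length≡
    ; edges↭ = begin
        cycleEdges C ++ allEdges cs
          ↭⟨ ++⁺ˡ (cycleEdges C) edges↭ ⟩
        cycleEdges C ++ map edge₁ A₁ ++ map edge₂ A₂
          ≡⟨ cong (_++ map edge₁ A₁ ++ map edge₂ A₂) C≡ ⟨
        map edge₁ (cycleEdges C′) ++ map edge₁ A₁ ++ map edge₂ A₂
          ≡⟨ ++-assoc (map edge₁ (cycleEdges C′)) _ _ ⟨
        (map edge₁ (cycleEdges C′) ++ map edge₁ A₁) ++ map edge₂ A₂
          ≡⟨ cong (_++ map edge₂ A₂) (map-++ edge₁ (cycleEdges C′) A₁) ⟨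
        map edge₁ (allEdges (C′ ∷ cycles₁)) ++ map edge₂ A₂
          ∎ }
    where
    open Separated (separate cs sides)
    open PermutationReasoning
    A₁ : List (E G₁)
    A₁ = allEdges cycles₁
    A₂ : List (E G₂)
    A₂ = allEdges cycles₂
  separate (C ∷ cs) (inj₂ inG₂ ∷ sides) with P₂.pullCycle C inG₂
  ... | (C′ , C≡) = record
    { cycles₁ = cycles₁ ; cycles₂ = C′ ∷ cycles₂
    ; length≡ = trans (cong suc length≡) (sym (+-suc (length cycles₁) (length cycles₂)))
    ; edges↭ = begin
        cycleEdges C ++ allEdges cs
          ↭⟨ ++⁺ˡ (cycleEdges C) edges↭ ⟩
        cycleEdges C ++ map edge₁ A₁ ++ map edge₂ A₂
          ↭⟨ shifts (cycleEdges C) (map edge₁ A₁) ⟩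
        map edge₁ A₁ ++ cycleEdges C ++ map edge₂ A₂
          ≡⟨ cong (λ l → map edge₁ A₁ ++ l ++ map edge₂ A₂) C≡ ⟨
        map edge₁ A₁ ++ map edge₂ (cycleEdges C′) ++ map edge₂ A₂
          ≡⟨ cong (map edge₁ A₁ ++_) (map-++ edge₂ (cycleEdges C′) A₂) ⟨
        map edge₁ A₁ ++ map edge₂ (allEdges (C′ ∷ cycles₂))
          ∎ }
    where
    open Separated (separate cs sides)
    open PermutationReasoning
    A₁ : List (E G₁)
    A₁ = allEdges cycles₁
    A₂ : List (E G₂)
    A₂ = allEdges cycles₂

  combine : List (CycleWalk {G₁}) → List (CycleWalk {G₂}) → List (CycleWalk {H})
  combine cs₁ cs₂ = map P₁.pushCycle cs₁ ++ map P₂.pushCycle cs₂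

  allEdges-combine : ∀ cs₁ cs₂ →
    allEdges (combine cs₁ cs₂) ≡ map edge₁ (allEdges cs₁) ++ map edge₂ (allEdges cs₂)
  allEdges-combine cs₁ cs₂ =
    trans (allEdges-++ (map P₁.pushCycle cs₁) _)
          (cong₂ _++_ (P₁.allEdges-pushCycles cs₁) (P₂.allEdges-pushCycles cs₂))

  length-combine : ∀ cs₁ cs₂ → length (combine cs₁ cs₂) ≡ length cs₁ + length cs₂
  length-combine cs₁ cs₂ =
    trans (length-++ (map P₁.pushCycle cs₁))
          (cong₂ _+_ (length-map P₁.pushCycle cs₁) (length-map P₂.pushCycle cs₂))

-- One side of a graph H: a set L of vertices, the edges S₁ that stay inside L
-- and the remaining edges S₂, which can touch L only at vertices of `Cut`.
-- A walk that enters L and avoids the cut therefore never leaves L.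
module Side {H : Graph} (L Cut : V H → Set) (S₁ S₂ : E H → Set)
  (inside : ∀ {e x y} → S₁ e → Joins H e x y → L x × L y)
  (touch  : ∀ {e x y} → S₂ e → Joins H e x y → L x → Cut x) where

  S₁₂ : E H → Set
  S₁₂ e = S₁ e ⊎ S₂ e

  forward : ∀ {x y} (W : Walk {H} x y) → L x → (∀ {v} → v ∈ sources W → ¬ Cut v) →
            All S₁₂ (edges W) → All S₁ (edges W) × L y
  forward nil          Lx avoid []              = [] , Lx
  forward (cons e j W) Lx avoid (inj₁ s ∷ S₁₂s) =
    let (S₁s , Ly) = forward W (proj₂ (inside s j)) (avoid ∘ there) S₁₂s in (s ∷ S₁s) , Ly
  forward (cons e j W) Lx avoid (inj₂ s ∷ S₁₂s) = ⊥-elim (avoid (here refl) (touch s j Lx))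

  backward : ∀ {x y} (W : Walk {H} x y) → L y → (∀ {v} → v ∈ targets W → ¬ Cut v) →
             All S₁₂ (edges W) → All S₁ (edges W) × L x
  backward nil Ly avoid [] = [] , Ly
  backward (cons e j W) Ly avoid (s₁₂ ∷ S₁₂s)
    with backward W Ly (λ v∈ → avoid (subst (_ ∈_) (sym (vertices≡∷targets W)) (there v∈))) S₁₂s
  ... | (S₁s , Lm) with s₁₂
  ...   | inj₁ s = (s ∷ S₁s) , proj₁ (inside s j)
  ...   | inj₂ s = ⊥-elim (avoid (subst (_ ∈_) (sym (vertices≡∷targets W)) (here refl))
                                 (touch s (Joins-sym {H} j) Lm))

-- With a single cut vertex w: a cycle whose closing edge lies inside L lies
-- entirely inside L.  If it passes through w, it does so only once, and the
-- two arcs on either side of w are handled by `forward` and `backward`.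
module OneCutVertex {H : Graph} (_≟_ : DecidableEquality (V H)) (L : V H → Set) (w : V H)
  (S₁ S₂ : E H → Set)
  (inside : ∀ {e x y} → S₁ e → Joins H e x y → L x × L y)
  (touch  : ∀ {e x y} → S₂ e → Joins H e x y → L x → x ≡ w) where
  open Side L (_≡ w) S₁ S₂ inside touch public

  classify : (C : CycleWalk {H}) → S₁ (CycleWalk.closing C) →
             All S₁₂ (edges (CycleWalk.path C)) → All S₁ (cycleEdges C)
  classify (mkCycleWalk e j P _ uV _) s S₁₂s with inside s j | any? (w ≟_) (vertices P)
  ... | (Lend , Lstart) | no w∉P =
    s ∷ proj₁ (forward P Lstart (λ v∈ v≡w → w∉P (subst (_∈ _) v≡w (sources⊆vertices P v∈))) S₁₂s)
  ... | (Lend , Lstart) | yes w∈P =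
    s ∷ subst (All S₁) (sym edges≡)
          (All.++⁺ (proj₁ (forward before Lstart (proj₁ avoids) (All.++⁻ˡ (edges before) S₁₂s′)))
                   (proj₁ (backward after Lend (proj₂ avoids) (All.++⁻ʳ (edges before) S₁₂s′))))
    where
    split : VertexSplit P w
    split = splitAtVertex P w∈P
    open VertexSplit split
    S₁₂s′ : All S₁₂ (edges before ++ edges after)
    S₁₂s′ = subst (All S₁₂) edges≡ S₁₂s
    avoids : (∀ {u} → u ∈ sources before → u ≢ w) × (∀ {u} → u ∈ targets after → u ≢ w)
    avoids = split-avoids P uV split

∖-dec : {a : A} → DecidableEquality A → DecidableEquality (A ∖ a)
∖-dec _≟_ p q with elt p ≟ elt q
... | yes eq = yes (elt-injective eq)
... | no neq = no (neq ∘ cong elt)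

module Gluing {V₁ V₂ : Set} (_≟_ : DecidableEquality V₂) (w : V₂) (w′ : V₁) where

  g : V₂ → V₁ ⊎ (V₂ ∖ w)
  g = glue _≟_ w w′

  g-glued : g w ≡ inj₁ w′
  g-glued with w ≟ w
  ... | yes _  = refl
  ... | no w≢w = ⊥-elim (w≢w refl)

  g-inj₁ : ∀ {a z} → g a ≡ inj₁ z → (a ≡ w) × (z ≡ w′)
  g-inj₁ {a} eq with a ≟ w
  ... | yes a≡w = a≡w , sym (inj₁-injective eq)

  g-inj₂ : ∀ {a r} → g a ≡ inj₂ r → elt r ≡ a
  g-inj₂ {a} eq with a ≟ w
  ... | no _ = sym (cong elt (inj₂-injective eq))

  g-unglued : ∀ {a} → a ≢ w → ∃ λ r → g a ≡ inj₂ r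
  g-unglued {a} a≢w with a ≟ w
  ... | yes a≡w = ⊥-elim (a≢w a≡w)
  ... | no a≢w′ = ⟨ a , a≢w′ ⟩ , refl

  g-injective : ∀ {a b} → g a ≡ g b → a ≡ b
  g-injective {a} {b} eq with g a in ga | g b in gb
  g-injective refl | inj₁ z | inj₁ .z = trans (proj₁ (g-inj₁ ga)) (sym (proj₁ (g-inj₁ gb)))
  g-injective refl | inj₂ r | inj₂ .r = trans (sym (g-inj₂ ga)) (g-inj₂ gb)

  InImage : V₁ ⊎ (V₂ ∖ w) → Set
  InImage v = (v ≡ inj₁ w′) ⊎ (∃ λ r → inj₂ r ≡ v)

  g-in-image : ∀ a → InImage (g a)
  g-in-image a with g a in ga
  ... | inj₁ z = inj₁ (cong inj₁ (proj₂ (g-inj₁ ga)))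
  ... | inj₂ r = inj₂ (r , refl)

-- A decomposition of G, opened up at e₀, is a path of
-- G - e₀ between the ends of e₀ plus a decomposition of the remaining edges
-- into cycles of G - e₀; and conversely such data closes up to a
-- decomposition of G with one more cycle.
Minus : (G : Graph) → E G → Graph
Minus G e = record { V = V G ; E = E G ∖ e ; ends = λ f → ends G (elt f) }

walk-nonempty : {G : Graph} {x y : V G} (w : Walk {G} x y) → x ≢ y → 1 ≤ length (edges w)
walk-nonempty nil          x≢y = ⊥-elim (x≢y refl)
walk-nonempty (cons _ _ _) x≢y = s≤s z≤n

module EdgeDeletion (G : Graph) (e₀ : E G) where
  G′ : Graph
  G′ = Minus G e₀

  deletion : Embedding G′ G
  deletion = record
    { vertex = λ v → v ; edge = elt ; vertex-injective = λ p → p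
    ; edge-injective = elt-injective ; ends-commute = λ f → refl }
  module D = EmbeddingProperties deletion

  avoiding-in-image : (l : List (E G)) → e₀ ∉ l → All D.InImage l
  avoiding-in-image []      e₀∉ = []
  avoiding-in-image (f ∷ l) e₀∉ =
    (⟨ f , (λ f≡e₀ → e₀∉ (here (sym f≡e₀))) ⟩ , refl) ∷ avoiding-in-image l (e₀∉ ∘ there)

  restrict : (cs : List (CycleWalk {G})) → e₀ ∉ allEdges cs →
             Σ (List (CycleWalk {G′})) λ cs′ → (map elt (allEdges cs′) ≡ allEdges cs) × (length cs′ ≡ length cs)
  restrict []       e₀∉ = [] , refl , refl
  restrict (C ∷ cs) e₀∉ =
    let (C′ , C≡) = D.pullCycle C (avoiding-in-image (cycleEdges C) (e₀∉ ∘ ∈-++⁺ˡ))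
        (cs′ , cs≡ , length≡) = restrict cs (e₀∉ ∘ ∈-++⁺ʳ (cycleEdges C))
    in (C′ ∷ cs′) , trans (map-++ elt (cycleEdges C′) (allEdges cs′)) (cong₂ _++_ C≡ cs≡) , cong suc length≡

  close : ∀ {u v y} → Joins G e₀ v u → u ≢ v → (w : Walk {G′} u y) → y ≡ v →
          Unique (vertices w) → Unique (edges w) →
          Σ (CycleWalk {G}) λ C → cycleEdges C ≡ e₀ ∷ map elt (edges w)
  close j u≢v w refl uV uE =
    mkCycleWalk e₀ j (D.pushWalk w)
      (subst (λ l → 1 ≤ length l) (sym edges≡)
        (subst (1 ≤_) (sym (length-map elt (edges w))) (walk-nonempty w u≢v)))
      (subst Unique (sym (trans (D.vertices-pushWalk w) (map-id (vertices w)))) uV)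
      (subst (λ l → Unique (e₀ ∷ l)) (sym edges≡)
        (unique-cons (removed∉map-elt (edges w)) (unique-map⁺ elt-injective uE))) ,
    cong (e₀ ∷_) edges≡
    where
    edges≡ : edges (D.pushWalk w) ≡ map elt (edges w)
    edges≡ = D.edges-pushWalk w

  record Opened (D : Decomposition {G}) (u v : V G) : Set where
    field
      walk            : Walk {G′} u v
      vertices-unique : Unique (vertices walk)
      rest            : List (CycleWalk {G′})
      exact           : Exact (E G ∖ e₀) (edges walk ++ allEdges rest)
      size≡           : size D ≡ suc (length rest)

  -- opening a decomposition at e₀: the cycle through e₀, oriented from u to
  -- v and with e₀ removed, is a path of G - e₀; the other cycles avoid e₀
  open-at : (D : Decomposition {G}) → ∀ {u v} → Joins G e₀ u v → Opened D u v
  open-at D {u} {v} J = record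
    { walk = castᵂ refl end≡ walk
    ; vertices-unique = subst Unique (sym (trans (vertices-castᵂ refl end≡ walk)
                                            (trans (sym (map-id (vertices walk))) vertices≡)))
                          (Oriented.vertices-unique oriented)
    ; rest = rest′
    ; exact = exact-∖⁻ (subst (Exact (E G)) edges≡′ (exact-resp-↭ edges↭′ (Decomposition.exact D)))
    ; size≡ = trans length≡ (cong suc (sym length≡′)) }
    where
    open Extraction (extract (Decomposition.cycles D) (proj₂ (Decomposition.exact D) e₀))
    oriented : Oriented e₀ u v cycle
    oriented = orient cycle closes-f J
    P : Walk {G} u v
    P = Oriented.walk oriented
    open D.PulledWalk (D.pullWalk P refl (avoiding-in-image (edges P)
                        (Unique[x∷xs]⇒x∉xs (Oriented.edges-unique oriented))))
    e₀∉rest : e₀ ∉ allEdges rest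
    e₀∉rest m = unique-++-disjoint (cycleEdges cycle)
                  (unique-resp-↭ edges↭ (proj₁ (Decomposition.exact D))) (here (sym closes-f) , m)
    restricted : Σ (List (CycleWalk {G′})) λ cs′ →
                   (map elt (allEdges cs′) ≡ allEdges rest) × (length cs′ ≡ length rest)
    restricted = restrict rest e₀∉rest
    rest′ : List (CycleWalk {G′})
    rest′ = proj₁ restricted
    length≡′ : length rest′ ≡ length rest
    length≡′ = proj₂ (proj₂ restricted)
    edges↭′ : allEdges (Decomposition.cycles D) ↭ (e₀ ∷ edges P) ++ allEdges rest
    edges↭′ = ↭-trans edges↭ (++⁺ʳ (allEdges rest) (Oriented.edges↭ oriented))
    edges≡′ : (e₀ ∷ edges P) ++ allEdges rest ≡
              e₀ ∷ map elt (edges (castᵂ refl end≡ walk) ++ allEdges rest′)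
    edges≡′ = cong (e₀ ∷_) (begin
      edges P ++ allEdges rest                            ≡⟨ cong₂ _++_ edges≡ (proj₁ (proj₂ restricted)) ⟨
      map elt (edges walk) ++ map elt (allEdges rest′)    ≡⟨ map-++ elt (edges walk) (allEdges rest′) ⟨
      map elt (edges walk ++ allEdges rest′)              ≡⟨ cong (λ l → map elt (l ++ allEdges rest′))
                                                               (edges-castᵂ refl end≡ walk) ⟨
      map elt (edges (castᵂ refl end≡ walk) ++ allEdges rest′) ∎)
      where open ≡-Reasoning

  closed-up : DecidableEquality (E G) → (C : CycleWalk {G}) (ws : List (E G ∖ e₀)) →
              cycleEdges C ≡ e₀ ∷ map elt ws → (cs′ : List (CycleWalk {G′})) →
              Exact (E G ∖ e₀) (ws ++ allEdges cs′) →
              Σ (Decomposition {G}) λ D → size D ≡ suc (length cs′)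
  closed-up _≟_ C ws C≡ cs′ exact′ =
    record { cycles = C ∷ map D.pushCycle cs′
           ; exact = subst (Exact (E G)) (sym edges≡) (exact-∖ _≟_ exact′) } ,
    cong suc (length-map D.pushCycle cs′)
    where
    edges≡ : allEdges (C ∷ map D.pushCycle cs′) ≡ e₀ ∷ map elt (ws ++ allEdges cs′)
    edges≡ = trans (cong₂ _++_ C≡ (D.allEdges-pushCycles cs′))
                   (cong (e₀ ∷_) (sym (map-++ elt ws (allEdges cs′))))


record SizeCorrespondence (G₁ G₂ H : Graph) (k : ℕ) : Set where
  field
    compose   : (D₁ : Decomposition {G₁}) (D₂ : Decomposition {G₂}) →
                Σ (Decomposition {H}) λ D → size D₁ + size D₂ ≡ k + size D
    decompose : (D : Decomposition {H}) →
                Σ (Decomposition {G₁}) λ D₁ → Σ (Decomposition {G₂}) λ D₂ → size D₁ + size D₂ ≡ k + size D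

-- The glued vertex
-- separates H, so each side is left only through it; consequently a cycle
-- whose closing edge comes from one side lies entirely on that side.
module GluedSides (G₁ G₂ : Graph) (dec₁ : DecidableEquality (V G₁)) (dec₂ : DecidableEquality (V G₂))
  (w₁ : V G₁) (w₂ : V G₂) {EH : Set}
  (endsH : EH → (V G₁ ⊎ (V G₂ ∖ w₂)) × (V G₁ ⊎ (V G₂ ∖ w₂)))
  (edge₁ : E G₁ → EH) (edge₁-injective : ∀ {a b} → edge₁ a ≡ edge₁ b → a ≡ b)
  (ends₁ : ∀ e → endsH (edge₁ e) ≡ pair inj₁ (ends G₁ e))
  (edge₂ : E G₂ → EH) (edge₂-injective : ∀ {a b} → edge₂ a ≡ edge₂ b → a ≡ b)
  (ends₂ : ∀ e → endsH (edge₂ e) ≡ pair (glue dec₂ w₂ w₁) (ends G₂ e)) where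

  H : Graph
  H = record { V = V G₁ ⊎ (V G₂ ∖ w₂) ; E = EH ; ends = endsH }
  open Gluing dec₂ w₂ w₁ public

  M₁ : Embedding G₁ H
  M₁ = record { vertex = inj₁ ; edge = edge₁ ; vertex-injective = inj₁-injective
              ; edge-injective = edge₁-injective ; ends-commute = ends₁ }
  M₂ : Embedding G₂ H
  M₂ = record { vertex = g ; edge = edge₂ ; vertex-injective = g-injective
              ; edge-injective = edge₂-injective ; ends-commute = ends₂ }
  open TwoEmbeddings M₁ M₂ public

  InG₁ : V H → Set
  InG₁ v = ∃ λ a → inj₁ a ≡ v

  G₁-inside : ∀ {e x y} → P₁.InImage e → Joins H e x y → InG₁ x × InG₁ y
  G₁-inside (e′ , refl) j = P₁.ends-in-image {e′} j

  G₁-touch : ∀ {e x y} → P₂.InImage e → Joins H e x y → InG₁ x → x ≡ inj₁ w₁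
  G₁-touch (e′ , refl) j (b , refl) =
    let (a , ga≡) = proj₁ (P₂.ends-in-image {e′} j) in cong inj₁ (proj₂ (g-inj₁ ga≡))

  G₂-inside : ∀ {e x y} → P₂.InImage e → Joins H e x y → InImage x × InImage y
  G₂-inside (e′ , refl) j with P₂.ends-in-image {e′} j
  ... | ((a , refl) , (b , refl)) = g-in-image a , g-in-image b

  G₂-touch : ∀ {e x y} → P₁.InImage e → Joins H e x y → InImage x → x ≡ inj₁ w₁
  G₂-touch (e′ , refl) j (inj₁ x≡w₁)       = x≡w₁
  G₂-touch (e′ , refl) j (inj₂ (r , refl)) with proj₁ (P₁.ends-in-image {e′} j)
  ... | (a , ())

  decH : DecidableEquality (V H)
  decH = ≡-dec dec₁ (∖-dec dec₂)

  module Side₁ = OneCutVertex decH InG₁    (inj₁ w₁) P₁.InImage P₂.InImage G₁-inside G₁-touch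
  module Side₂ = OneCutVertex decH InImage (inj₁ w₁) P₂.InImage P₁.InImage G₂-inside G₂-touch

module VertexJoin (G₁ G₂ : Graph) (dec₁ : DecidableEquality (V G₁)) (dec₂ : DecidableEquality (V G₂))
                  (w₁ : V G₁) (w₂ : V G₂) where
  open GluedSides G₁ G₂ dec₁ dec₂ w₁ w₂ (ends (joinV G₁ w₁ G₂ dec₂ w₂))
         inj₁ inj₁-injective (λ _ → refl) inj₂ inj₂-injective (λ _ → refl)

  edge-sides : ∀ e → P₁.InImage e ⊎ P₂.InImage e
  edge-sides (inj₁ e) = inj₁ (e , refl)
  edge-sides (inj₂ e) = inj₂ (e , refl)

  -- the cut argument, applied to the side of the closing edge
  on-one-side : (C : CycleWalk {H}) → OnOneSide C
  on-one-side C@(mkCycleWalk (inj₁ e) _ P _ _ _) =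
    inj₁ (Side₁.classify C (e , refl) (All.universal edge-sides (edges P)))
  on-one-side C@(mkCycleWalk (inj₂ e) _ P _ _ _) =
    inj₂ (Side₂.classify C (e , refl) (All.universal (⊎-swap ∘ edge-sides) (edges P)))

  compose : (D₁ : Decomposition {G₁}) (D₂ : Decomposition {G₂}) →
            Σ (Decomposition {H}) λ D → size D₁ + size D₂ ≡ size D
  compose D₁ D₂ =
    record { cycles = combine cs₁ cs₂
           ; exact = subst (Exact (E H)) (sym (allEdges-combine cs₁ cs₂))
                       (exact-⊎ (Decomposition.exact D₁) (Decomposition.exact D₂)) } ,
    sym (length-combine cs₁ cs₂)
    where
    cs₁ : List (CycleWalk {G₁})
    cs₁ = Decomposition.cycles D₁
    cs₂ : List (CycleWalk {G₂})
    cs₂ = Decomposition.cycles D₂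

  decompose : (D : Decomposition {H}) →
              Σ (Decomposition {G₁}) λ D₁ → Σ (Decomposition {G₂}) λ D₂ → size D₁ + size D₂ ≡ size D
  decompose D =
    record { cycles = cycles₁ ; exact = proj₁ exacts } ,
    record { cycles = cycles₂ ; exact = proj₂ exacts } ,
    sym length≡
    where
    cs : List (CycleWalk {H})
    cs = Decomposition.cycles D
    open Separated (separate cs (All.universal on-one-side cs))
    exacts : Exact (E G₁) (allEdges cycles₁) × Exact (E G₂) (allEdges cycles₂)
    exacts = exact-⊎⁻ (exact-resp-↭ edges↭ (Decomposition.exact D))

  vertexJoinCorrespondence : SizeCorrespondence G₁ G₂ (joinV G₁ w₁ G₂ dec₂ w₂) 0
  vertexJoinCorrespondence = record { compose = compose ; decompose = decompose }

-- Edge bookkeeping for ⊙_E and ⊙_VE, whose edge sets have the shape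
-- A ⊎ (B ⊎ T) with T the new edges: the edges of the crossing cycle together
-- with the cycles on either side are exact iff both sides are.
module CrossingEdges {A B T : Set} (t : T) (ts : List T) where

  ι₁ : A → A ⊎ (B ⊎ T)
  ι₁ = inj₁
  ι₂ : B → A ⊎ (B ⊎ T)
  ι₂ b = inj₂ (inj₁ b)
  new : T → A ⊎ (B ⊎ T)
  new t = inj₂ (inj₂ t)

  -- the edges of the crossing cycle: new edges, a path of G₁ and a path of G₂
  crossing : List A → List B → List (A ⊎ (B ⊎ T))
  crossing W₁ W₂ = new t ∷ (map ι₁ W₁ ++ map new ts ++ map ι₂ W₂)

  regroup : ∀ {X : Set} (n : X) (a ns b c d : List X) →
            (n ∷ (a ++ ns ++ b)) ++ (c ++ d) ↭ (a ++ c) ++ ((b ++ d) ++ (n ∷ ns))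
  regroup n a ns b c d = begin
    n ∷ ((a ++ ns ++ b) ++ c ++ d)     ≡⟨ cong (n ∷_) (++-assoc a (ns ++ b) (c ++ d)) ⟩
    n ∷ (a ++ (ns ++ b) ++ c ++ d)     ≡⟨ cong (λ l → n ∷ (a ++ l)) (++-assoc ns b (c ++ d)) ⟩
    n ∷ (a ++ ns ++ b ++ c ++ d)       ↭⟨ shift n a (ns ++ b ++ c ++ d) ⟨
    a ++ (n ∷ ns) ++ b ++ c ++ d       ↭⟨ ++⁺ˡ a (++-comm (n ∷ ns) (b ++ c ++ d)) ⟩
    a ++ (b ++ c ++ d) ++ (n ∷ ns)     ↭⟨ ++⁺ˡ a (++⁺ʳ (n ∷ ns) (shifts b c)) ⟩
    a ++ (c ++ b ++ d) ++ (n ∷ ns)     ≡⟨ cong (a ++_) (++-assoc c (b ++ d) (n ∷ ns)) ⟩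
    a ++ c ++ (b ++ d) ++ (n ∷ ns)     ≡⟨ ++-assoc a c _ ⟨
    (a ++ c) ++ (b ++ d) ++ (n ∷ ns)   ∎
    where open PermutationReasoning

  canonical : ∀ W₁ R₁ W₂ R₂ →
    (map ι₁ W₁ ++ map ι₁ R₁) ++ ((map ι₂ W₂ ++ map ι₂ R₂) ++ map new (t ∷ ts))
    ≡ map inj₁ (W₁ ++ R₁) ++ map inj₂ (map inj₁ (W₂ ++ R₂) ++ map inj₂ (t ∷ ts))
  canonical W₁ R₁ W₂ R₂ = cong₂ _++_ (sym (map-++ inj₁ W₁ R₁)) (begin
    (map ι₂ W₂ ++ map ι₂ R₂) ++ map new (t ∷ ts)
      ≡⟨ cong (_++ map new (t ∷ ts)) (map-++ ι₂ W₂ R₂) ⟨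
    map ι₂ (W₂ ++ R₂) ++ map new (t ∷ ts)
      ≡⟨ cong₂ _++_ (map-∘ (W₂ ++ R₂)) (map-∘ (t ∷ ts)) ⟩
    map inj₂ (map inj₁ (W₂ ++ R₂)) ++ map inj₂ (map inj₂ (t ∷ ts))
      ≡⟨ map-++ inj₂ (map inj₁ (W₂ ++ R₂)) _ ⟨
    map inj₂ (map inj₁ (W₂ ++ R₂) ++ map inj₂ (t ∷ ts))
      ∎)
    where open ≡-Reasoning

  crossing↭ : ∀ W₁ R₁ W₂ R₂ →
    crossing W₁ W₂ ++ (map ι₁ R₁ ++ map ι₂ R₂)
    ↭ map inj₁ (W₁ ++ R₁) ++ map inj₂ (map inj₁ (W₂ ++ R₂) ++ map inj₂ (t ∷ ts))
  crossing↭ W₁ R₁ W₂ R₂ =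
    subst (crossing W₁ W₂ ++ (map ι₁ R₁ ++ map ι₂ R₂) ↭_) (canonical W₁ R₁ W₂ R₂)
          (regroup (new t) (map ι₁ W₁) (map new ts) (map ι₂ W₂) (map ι₁ R₁) (map ι₂ R₂))

  exact-crossing : ∀ {W₁ R₁ W₂ R₂} → Exact T (t ∷ ts) → Exact A (W₁ ++ R₁) → Exact B (W₂ ++ R₂) →
                   Exact (A ⊎ (B ⊎ T)) (crossing W₁ W₂ ++ (map ι₁ R₁ ++ map ι₂ R₂))
  exact-crossing {W₁} {R₁} {W₂} {R₂} exactT exact₁ exact₂ =
    exact-resp-↭ (↭-sym (crossing↭ W₁ R₁ W₂ R₂)) (exact-⊎ exact₁ (exact-⊎ exact₂ exactT))

  exact-crossing⁻ : ∀ {W₁ R₁ W₂ R₂} → Exact (A ⊎ (B ⊎ T)) (crossing W₁ W₂ ++ (map ι₁ R₁ ++ map ι₂ R₂)) →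
                    Exact A (W₁ ++ R₁) × Exact B (W₂ ++ R₂)
  exact-crossing⁻ {W₁} {R₁} {W₂} {R₂} exact =
    let (exact₁ , exact₂₃) = exact-⊎⁻ (exact-resp-↭ (crossing↭ W₁ R₁ W₂ R₂) exact)
    in exact₁ , proj₁ (exact-⊎⁻ exact₂₃)

-- In a
-- decomposition of H exactly one cycle uses the new edges: it consists of
-- them, a path u₁ ⋯ v₁ of G₁ - e₁ and a path v₂ ⋯ u₂ of G₂ - e₂.  Closing
-- these paths with e₁ and e₂ turns that one cycle into two, and conversely,
-- so that |D₁| + |D₂| = 1 + |D|.  The operation-specific facts (how to find
-- the two paths, how to join them) are the two arguments of `correspondence`.
module EdgeJoin (G₁ G₂ : Graph)
  (decE₁ : DecidableEquality (E G₁)) (decE₂ : DecidableEquality (E G₂))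
  (e₁ : E G₁) (u₁ v₁ : V G₁) (J₁ : Joins G₁ e₁ u₁ v₁) (u₁≢v₁ : u₁ ≢ v₁)
  (e₂ : E G₂) (u₂ v₂ : V G₂) (J₂ : Joins G₂ e₂ u₂ v₂) (u₂≢v₂ : u₂ ≢ v₂)
  {T : Set} (t : T) (ts : List T) (exactT : Exact T (t ∷ ts))
  (VH : Set) (endsH : (E G₁ ∖ e₁) ⊎ ((E G₂ ∖ e₂) ⊎ T) → VH × VH)
  (f₁ : V G₁ → VH) (f₁-injective : ∀ {a b} → f₁ a ≡ f₁ b → a ≡ b)
  (f₂ : V G₂ → VH) (f₂-injective : ∀ {a b} → f₂ a ≡ f₂ b → a ≡ b)
  (ends₁ : ∀ e → endsH (inj₁ e) ≡ pair f₁ (ends G₁ (elt e)))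
  (ends₂ : ∀ e → endsH (inj₂ (inj₁ e)) ≡ pair f₂ (ends G₂ (elt e)))
  (ends-t : endsH (inj₂ (inj₂ t)) ≡ (f₁ u₁ , f₂ u₂)) where

  H : Graph
  H = record { V = VH ; E = (E G₁ ∖ e₁) ⊎ ((E G₂ ∖ e₂) ⊎ T) ; ends = endsH }

  module E₁ = EdgeDeletion G₁ e₁
  module E₂ = EdgeDeletion G₂ e₂
  open CrossingEdges {E G₁ ∖ e₁} {E G₂ ∖ e₂} t ts public

  M₁ : Embedding E₁.G′ H
  M₁ = record { vertex = f₁ ; edge = ι₁ ; vertex-injective = f₁-injective
              ; edge-injective = inj₁-injective ; ends-commute = ends₁ }
  M₂ : Embedding E₂.G′ H
  M₂ = record { vertex = f₂ ; edge = ι₂ ; vertex-injective = f₂-injective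
              ; edge-injective = inj₁-injective ∘ inj₂-injective ; ends-commute = ends₂ }
  open TwoEmbeddings M₁ M₂ public

  old-edges : (l : List (E H)) → (∀ {s} → new s ∉ l) → All (λ e → P₁.InImage e ⊎ P₂.InImage e) l
  old-edges []                  fresh = []
  old-edges (inj₁ e ∷ l)        fresh = inj₁ (e , refl) ∷ old-edges l (fresh ∘ there)
  old-edges (inj₂ (inj₁ e) ∷ l) fresh = inj₂ (e , refl) ∷ old-edges l (fresh ∘ there)
  old-edges (inj₂ (inj₂ s) ∷ l) fresh = ⊥-elim (fresh (here refl))

  record CrossingWalk (cs : List (CycleWalk {H})) : Set where
    field
      walk            : Walk {H} (f₁ u₁) (f₂ u₂)
      vertices-unique : Unique (vertices walk)
      edges-unique    : Unique (new t ∷ edges walk)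
      rest            : List (CycleWalk {H})
      edges↭          : allEdges cs ↭ (new t ∷ edges walk) ++ allEdges rest
      length≡         : length cs ≡ suc (length rest)

  crossingWalk : (D : Decomposition {H}) → CrossingWalk (Decomposition.cycles D)
  crossingWalk D = record
    { walk = Oriented.walk oriented
    ; vertices-unique = Oriented.vertices-unique oriented
    ; edges-unique = Oriented.edges-unique oriented
    ; rest = rest
    ; edges↭ = ↭-trans edges↭ (++⁺ʳ (allEdges rest) (Oriented.edges↭ oriented))
    ; length≡ = length≡ }
    where
    open Extraction (extract (Decomposition.cycles D) (proj₂ (Decomposition.exact D) (new t)))
    oriented : Oriented (new t) (f₁ u₁) (f₂ u₂) cycle
    oriented = orient cycle closes-f (inj₁ ends-t)

  crossing-fresh : (D : Decomposition {H}) (cw : CrossingWalk (Decomposition.cycles D)) →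
                   ∀ {e} → e ∈ new t ∷ edges (CrossingWalk.walk cw) → e ∉ allEdges (CrossingWalk.rest cw)
  crossing-fresh D cw e∈ e∈rest =
    unique-++-disjoint (new t ∷ edges walk) (unique-resp-↭ edges↭ (proj₁ (Decomposition.exact D))) (e∈ , e∈rest)
    where open CrossingWalk cw

  all-on-one-side : (∀ C → (∀ {s} → new s ∉ cycleEdges C) → OnOneSide C) →
                    (rs : List (CycleWalk {H})) → (∀ {s} → new s ∉ allEdges rs) → All OnOneSide rs
  all-on-one-side one-side []       fresh = []
  all-on-one-side one-side (C ∷ rs) fresh =
    one-side C (fresh ∘ ∈-++⁺ˡ) ∷ all-on-one-side one-side rs (fresh ∘ ∈-++⁺ʳ (cycleEdges C))

  record CutOpen (cs : List (CycleWalk {H})) : Set where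
    field
      {y₁ y₂}          : _
      walk₁            : Walk {E₁.G′} u₁ y₁
      y₁≡v₁            : y₁ ≡ v₁
      walk₂            : Walk {E₂.G′} v₂ y₂
      y₂≡u₂            : y₂ ≡ u₂
      vertices-unique₁ : Unique (vertices walk₁)
      vertices-unique₂ : Unique (vertices walk₂)
      rest             : List (CycleWalk {H})
      rest-sides       : All OnOneSide rest
      edges↭           : allEdges cs ↭ crossing (edges walk₁) (edges walk₂) ++ allEdges rest
      length≡          : length cs ≡ suc (length rest)

  CrossingCycle : Set
  CrossingCycle = (w₁ : Walk {E₁.G′} u₁ v₁) (w₂ : Walk {E₂.G′} v₂ u₂) →
                  Unique (vertices w₁) → Unique (vertices w₂) → Unique (crossing (edges w₁) (edges w₂)) →
                  Σ (CycleWalk {H}) λ S → cycleEdges S ≡ crossing (edges w₁) (edges w₂)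

  close-both : (D : Decomposition {H}) → CutOpen (Decomposition.cycles D) →
               Σ (Decomposition {G₁}) λ D₁ → Σ (Decomposition {G₂}) λ D₂ → size D₁ + size D₂ ≡ 1 + size D
  close-both D cut = proj₁ D₁ , proj₁ D₂ , sizes
    where
    open CutOpen cut
    separated : Separated rest
    separated = separate rest rest-sides
    open Separated separated using (cycles₁; cycles₂)
    W₁ : List (E G₁ ∖ e₁)
    W₁ = edges walk₁
    W₂ : List (E G₂ ∖ e₂)
    W₂ = edges walk₂
    all↭ : allEdges (Decomposition.cycles D) ↭
           crossing W₁ W₂ ++ (map ι₁ (allEdges cycles₁) ++ map ι₂ (allEdges cycles₂))
    all↭ = ↭-trans edges↭ (++⁺ˡ (crossing W₁ W₂) (Separated.edges↭ separated))
    exact↭ : Exact (E H) (crossing W₁ W₂ ++ (map ι₁ (allEdges cycles₁) ++ map ι₂ (allEdges cycles₂)))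
    exact↭ = exact-resp-↭ all↭ (Decomposition.exact D)
    exacts : Exact (E G₁ ∖ e₁) (W₁ ++ allEdges cycles₁) × Exact (E G₂ ∖ e₂) (W₂ ++ allEdges cycles₂)
    exacts = exact-crossing⁻ {W₁} {allEdges cycles₁} {W₂} {allEdges cycles₂} exact↭
    unique-crossing : Unique (map ι₁ W₁ ++ map new ts ++ map ι₂ W₂)
    unique-crossing = unique-tail (unique-++ˡ (crossing W₁ W₂) (proj₁ exact↭))
    unique₁ : Unique W₁
    unique₁ = unique-map⁻ (unique-++ˡ (map ι₁ W₁) unique-crossing)
    unique₂ : Unique W₂
    unique₂ = unique-map⁻ {f = ι₂} (unique-++ʳ (map new ts) (unique-++ʳ (map ι₁ W₁) unique-crossing))
    C₁ : Σ (CycleWalk {G₁}) λ C → cycleEdges C ≡ e₁ ∷ map elt W₁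
    C₁ = E₁.close (Joins-sym {G₁} J₁) u₁≢v₁ walk₁ y₁≡v₁ vertices-unique₁ unique₁
    C₂ : Σ (CycleWalk {G₂}) λ C → cycleEdges C ≡ e₂ ∷ map elt W₂
    C₂ = E₂.close J₂ (u₂≢v₂ ∘ sym) walk₂ y₂≡u₂ vertices-unique₂ unique₂
    D₁ : Σ (Decomposition {G₁}) λ D₁ → size D₁ ≡ suc (length cycles₁)
    D₁ = E₁.closed-up decE₁ (proj₁ C₁) W₁ (proj₂ C₁) cycles₁ (proj₁ exacts)
    D₂ : Σ (Decomposition {G₂}) λ D₂ → size D₂ ≡ suc (length cycles₂)
    D₂ = E₂.closed-up decE₂ (proj₁ C₂) W₂ (proj₂ C₂) cycles₂ (proj₂ exacts)
    sizes : size (proj₁ D₁) + size (proj₁ D₂) ≡ 1 + size D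
    sizes = begin
      size (proj₁ D₁) + size (proj₁ D₂)          ≡⟨ cong₂ _+_ (proj₂ D₁) (proj₂ D₂) ⟩
      suc (length cycles₁) + suc (length cycles₂) ≡⟨ cong suc (+-suc (length cycles₁) (length cycles₂)) ⟩
      2 + (length cycles₁ + length cycles₂)       ≡⟨ cong (2 +_) (Separated.length≡ separated) ⟨
      2 + length rest                             ≡⟨ cong suc length≡ ⟨
      1 + size D                                  ∎
      where open ≡-Reasoning

  join-both : CrossingCycle → (D₁ : Decomposition {G₁}) (D₂ : Decomposition {G₂}) →
              Σ (Decomposition {H}) λ D → size D₁ + size D₂ ≡ 1 + size D
  join-both crossingCycle D₁ D₂ =
    record { cycles = S ∷ combine rest₁ rest₂
           ; exact = subst (Exact (E H)) (sym edges≡) exactAll } ,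
    sizes
    where
    open E₁.Opened (E₁.open-at D₁ J₁)
      renaming (walk to w₁; vertices-unique to uV₁; rest to rest₁; exact to exact₁; size≡ to size≡₁)
    open E₂.Opened (E₂.open-at D₂ (Joins-sym {G₂} J₂))
      renaming (walk to w₂; vertices-unique to uV₂; rest to rest₂; exact to exact₂; size≡ to size≡₂)
    exactAll : Exact (E H) (crossing (edges w₁) (edges w₂) ++ (map ι₁ (allEdges rest₁) ++ map ι₂ (allEdges rest₂)))
    exactAll = exact-crossing {edges w₁} {allEdges rest₁} {edges w₂} {allEdges rest₂} exactT exact₁ exact₂
    crossingS : Σ (CycleWalk {H}) λ S → cycleEdges S ≡ crossing (edges w₁) (edges w₂)
    crossingS = crossingCycle w₁ w₂ uV₁ uV₂ (unique-++ˡ (crossing (edges w₁) (edges w₂)) (proj₁ exactAll))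
    S : CycleWalk {H}
    S = proj₁ crossingS
    edges≡ : allEdges (S ∷ combine rest₁ rest₂) ≡
             crossing (edges w₁) (edges w₂) ++ (map ι₁ (allEdges rest₁) ++ map ι₂ (allEdges rest₂))
    edges≡ = cong₂ _++_ (proj₂ crossingS) (allEdges-combine rest₁ rest₂)
    sizes : size D₁ + size D₂ ≡ 1 + suc (length (combine rest₁ rest₂))
    sizes = begin
      size D₁ + size D₂                       ≡⟨ cong₂ _+_ size≡₁ size≡₂ ⟩
      suc (length rest₁) + suc (length rest₂) ≡⟨ cong suc (+-suc (length rest₁) (length rest₂)) ⟩
      2 + (length rest₁ + length rest₂)       ≡⟨ cong (2 +_) (length-combine rest₁ rest₂) ⟨
      2 + length (combine rest₁ rest₂)        ∎
      where open ≡-Reasoning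

  correspondence : CrossingCycle → ((D : Decomposition {H}) → CutOpen (Decomposition.cycles D)) →
                   SizeCorrespondence G₁ G₂ H 1
  correspondence crossingCycle cutOpen = record
    { compose = join-both crossingCycle
    ; decompose = λ D → close-both D (cutOpen D) }

-- Besides a = u₁u₂ the only edge between the two sides of
-- H = (G₁,e₁,u₁) ⊙_E (G₂,e₂,u₂) is b = v₁v₂, so the crossing cycle leaves G₁
-- along a and returns along b; no other cycle can change sides.
module EdgeEdgeJoin (G₁ G₂ : Graph)
  (decE₁ : DecidableEquality (E G₁)) (decE₂ : DecidableEquality (E G₂))
  (e₁ : E G₁) (u₁ v₁ : V G₁) (J₁ : Joins G₁ e₁ u₁ v₁) (u₁≢v₁ : u₁ ≢ v₁)
  (e₂ : E G₂) (u₂ v₂ : V G₂) (J₂ : Joins G₂ e₂ u₂ v₂) (u₂≢v₂ : u₂ ≢ v₂) where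

  open EdgeJoin G₁ G₂ decE₁ decE₂ e₁ u₁ v₁ J₁ u₁≢v₁ e₂ u₂ v₂ J₂ u₂≢v₂
         (inj₁ tt) [ inj₂ tt ] (exact-⊎ exact-⊤ exact-⊤)
         (V G₁ ⊎ V G₂) (ends (joinE G₁ e₁ u₁ v₁ G₂ e₂ u₂ v₂))
         inj₁ inj₁-injective inj₂ inj₂-injective (λ _ → refl) (λ _ → refl) refl
    public

  -- the new edges u₁u₂ and v₁v₂
  a b : E H
  a = new (inj₁ tt)
  b = new (inj₂ tt)

  InG₁ InG₂ : V H → Set
  InG₁ v = ∃ λ x → inj₁ x ≡ v
  InG₂ v = ∃ λ x → inj₂ x ≡ v

  G₁-inside : ∀ {e x y} → P₁.InImage e → Joins H e x y → InG₁ x × InG₁ y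
  G₁-inside (e′ , refl) j = P₁.ends-in-image {e′} j

  G₁-touch : ∀ {e x y} → P₂.InImage e → Joins H e x y → InG₁ x → ⊥
  G₁-touch (e′ , refl) j (z , refl) with proj₁ (P₂.ends-in-image {e′} j)
  ... | (_ , ())

  G₂-inside : ∀ {e x y} → P₂.InImage e → Joins H e x y → InG₂ x × InG₂ y
  G₂-inside (e′ , refl) j = P₂.ends-in-image {e′} j

  G₂-touch : ∀ {e x y} → P₁.InImage e → Joins H e x y → InG₂ x → ⊥
  G₂-touch (e′ , refl) j (z , refl) with proj₁ (P₁.ends-in-image {e′} j)
  ... | (_ , ())

  module Side₁ = Side InG₁ (λ _ → ⊥) P₁.InImage P₂.InImage G₁-inside G₁-touch
  module Side₂ = Side InG₂ (λ _ → ⊥) P₂.InImage P₁.InImage G₂-inside G₂-touch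

  stays₁ : ∀ {x y} (W : Walk {H} x y) → InG₁ x → (∀ {s} → new s ∉ edges W) →
           All P₁.InImage (edges W) × InG₁ y
  stays₁ W Lx fresh = Side₁.forward W Lx (λ _ ()) (old-edges (edges W) fresh)

  stays₂ : ∀ {x y} (W : Walk {H} x y) → InG₂ x → (∀ {s} → new s ∉ edges W) →
           All P₂.InImage (edges W) × InG₂ y
  stays₂ W Lx fresh = Side₂.forward W Lx (λ _ ()) (All.map ⊎-swap (old-edges (edges W) fresh))

  one-side : (C : CycleWalk {H}) → (∀ {s} → new s ∉ cycleEdges C) → OnOneSide C
  one-side (mkCycleWalk (inj₁ f) j P _ _ _) fresh =
    inj₁ ((f , refl) ∷ proj₁ (stays₁ P (proj₂ (P₁.ends-in-image {f} j)) (fresh ∘ there)))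
  one-side (mkCycleWalk (inj₂ (inj₁ f)) j P _ _ _) fresh =
    inj₂ ((f , refl) ∷ proj₁ (stays₂ P (proj₂ (P₂.ends-in-image {f} j)) (fresh ∘ there)))
  one-side (mkCycleWalk (inj₂ (inj₂ s)) _ _ _ _ _) fresh = ⊥-elim (fresh (here refl))

  b-crosses : ∀ {x y} (W : Walk {H} x y) → InG₁ x → InG₂ y → a ∉ edges W → b ∈ edges W
  b-crosses nil                                   (z , refl) (z′ , ()) a∉
  b-crosses (cons (inj₁ f) j W)                   Lx Ry a∉ =
    there (b-crosses W (proj₂ (P₁.ends-in-image {f} j)) Ry (a∉ ∘ there))
  b-crosses (cons (inj₂ (inj₁ f)) j W)            Lx Ry a∉ = ⊥-elim (G₁-touch (f , refl) j Lx)
  b-crosses (cons (inj₂ (inj₂ (inj₁ tt))) j W)    Lx Ry a∉ = ⊥-elim (a∉ (here refl))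
  b-crosses (cons (inj₂ (inj₂ (inj₂ tt))) j W)    Lx Ry a∉ = here refl

  -- The crossing walk u₁ ⋯ u₂ of a decomposition D uses b; split at b, it is
  -- a path of G₁ followed by a path of G₂.
  module CutAtB (D : Decomposition {H}) where
    cw : CrossingWalk (Decomposition.cycles D)
    cw = crossingWalk D
    open CrossingWalk cw public
    b∈walk : b ∈ edges walk
    b∈walk = b-crosses walk (u₁ , refl) (u₂ , refl) (Unique[x∷xs]⇒x∉xs edges-unique)
    fresh-rest : ∀ {s} → new s ∉ allEdges rest
    fresh-rest {inj₁ tt} = crossing-fresh D cw (here refl)
    fresh-rest {inj₂ tt} = crossing-fresh D cw (there b∈walk)
    fresh-parts : ∀ {m m′} (before : Walk {H} (inj₁ u₁) m) (after : Walk {H} m′ (inj₂ u₂)) →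
                  edges walk ≡ edges before ++ b ∷ edges after →
                  (∀ {s} → new s ∉ edges before) × (∀ {s} → new s ∉ edges after)
    fresh-parts before after edges≡ = fresh-before , fresh-after
      where
      unique′ : Unique (a ∷ (edges before ++ b ∷ edges after))
      unique′ = subst (λ l → Unique (a ∷ l)) edges≡ edges-unique
      fresh-before : ∀ {s} → new s ∉ edges before
      fresh-before {inj₁ tt} m = Unique[x∷xs]⇒x∉xs unique′ (∈-++⁺ˡ m)
      fresh-before {inj₂ tt} m = unique-++-disjoint (edges before) (unique-tail unique′) (m , here refl)
      fresh-after : ∀ {s} → new s ∉ edges after
      fresh-after {inj₁ tt} m = Unique[x∷xs]⇒x∉xs unique′ (∈-++⁺ʳ (edges before) (there m))
      fresh-after {inj₂ tt} m = Unique[x∷xs]⇒x∉xs (unique-++ʳ (edges before) (unique-tail unique′)) m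

    cut-at-b : EdgeSplit walk b → CutOpen (Decomposition.cycles D)
    cut-at-b record { before = before ; f-joins = inj₂ refl ; after = after ; edges≡ = edges≡ }
      with proj₂ (stays₁ before (u₁ , refl) (proj₁ (fresh-parts before after edges≡)))
    ... | (_ , ())
    cut-at-b record { before = before ; f-joins = inj₁ refl ; after = after
                    ; edges≡ = edges≡ ; vertices≡ = vertices≡ } = record
      { walk₁ = Q₁.walk ; y₁≡v₁ = inj₁-injective Q₁.end≡
      ; walk₂ = Q₂.walk ; y₂≡u₂ = inj₂-injective Q₂.end≡
      ; vertices-unique₁ = unique-map⁻ (subst Unique (sym Q₁.vertices≡) (unique-++ˡ (vertices before) unique′))
      ; vertices-unique₂ = unique-map⁻ (subst Unique (sym Q₂.vertices≡) (unique-++ʳ (vertices before) unique′))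
      ; rest = rest ; rest-sides = all-on-one-side one-side rest fresh-rest
      ; edges↭ = subst (λ l → allEdges (Decomposition.cycles D) ↭ l ++ allEdges rest) crossing≡ edges↭
      ; length≡ = length≡ }
      where
      unique′ : Unique (vertices before ++ vertices after)
      unique′ = subst Unique vertices≡ vertices-unique
      fresh : (∀ {s} → new s ∉ edges before) × (∀ {s} → new s ∉ edges after)
      fresh = fresh-parts before after edges≡
      module Q₁ = P₁.PulledWalk (P₁.pullWalk before refl (proj₁ (stays₁ before (u₁ , refl) (proj₁ fresh))))
      module Q₂ = P₂.PulledWalk (P₂.pullWalk after refl (proj₁ (stays₂ after (v₂ , refl) (proj₂ fresh))))
      crossing≡ : a ∷ edges walk ≡ crossing (edges Q₁.walk) (edges Q₂.walk)
      crossing≡ = cong (a ∷_) (trans edges≡ (cong₂ (λ p q → p ++ b ∷ q) (sym Q₁.edges≡) (sym Q₂.edges≡)))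

  cutOpen : (D : Decomposition {H}) → CutOpen (Decomposition.cycles D)
  cutOpen D = cut-at-b (splitAtEdge walk b∈walk)
    where open CutAtB D

  crossingCycle : CrossingCycle
  crossingCycle w₁ w₂ uV₁ uV₂ uE =
    mkCycleWalk a (inj₂ refl) Q
      (subst (λ l → 1 ≤ length l) (sym edges≡) (nonempty-++∷ (map ι₁ (edges w₁))))
      (subst Unique (sym vertices≡) (unique-⊎ uV₁ uV₂))
      (subst (λ l → Unique (a ∷ l)) (sym edges≡) uE) ,
    cong (a ∷_) edges≡
    where
    Q : Walk {H} (inj₁ u₁) (inj₂ u₂)
    Q = P₁.pushWalk w₁ ++ᵂ cons b (inj₁ refl) (P₂.pushWalk w₂)
    edges≡ : edges Q ≡ map ι₁ (edges w₁) ++ b ∷ map ι₂ (edges w₂)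
    edges≡ = trans (edges-++ᵂ (P₁.pushWalk w₁) _)
                   (cong₂ (λ p q → p ++ b ∷ q) (P₁.edges-pushWalk w₁) (P₂.edges-pushWalk w₂))
    vertices≡ : vertices Q ≡ map inj₁ (vertices w₁) ++ map inj₂ (vertices w₂)
    vertices≡ = begin
      vertices Q
        ≡⟨ vertices-++ᵂ (P₁.pushWalk w₁) _ ⟩
      sources (P₁.pushWalk w₁) ++ inj₁ v₁ ∷ vertices (P₂.pushWalk w₂)
        ≡⟨ cong₂ (λ p q → p ++ inj₁ v₁ ∷ q) (P₁.sources-pushWalk w₁) (P₂.vertices-pushWalk w₂) ⟩
      map inj₁ (sources w₁) ++ [ inj₁ v₁ ] ++ map inj₂ (vertices w₂)
        ≡⟨ ++-assoc (map inj₁ (sources w₁)) [ inj₁ v₁ ] _ ⟨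
      (map inj₁ (sources w₁) ++ [ inj₁ v₁ ]) ++ map inj₂ (vertices w₂)
        ≡⟨ cong (_++ map inj₂ (vertices w₂)) (map-++ inj₁ (sources w₁) [ v₁ ]) ⟨
      map inj₁ (sources w₁ ++ [ v₁ ]) ++ map inj₂ (vertices w₂)
        ≡⟨ cong (λ l → map inj₁ l ++ map inj₂ (vertices w₂)) (vertices≡sources∷ʳ w₁) ⟨
      map inj₁ (vertices w₁) ++ map inj₂ (vertices w₂)
        ∎
      where open ≡-Reasoning

  edgeJoinCorrespondence : SizeCorrespondence G₁ G₂ (joinE G₁ e₁ u₁ v₁ G₂ e₂ u₂ v₂) 1
  edgeJoinCorrespondence = correspondence crossingCycle cutOpen

-- In H = (G₁,e₁,u₁) ⊙_VE (G₂,e₂,u₂) the identified vertex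
-- v₁ = v₂ separates the two sides apart from the new edge c = u₁u₂.  The
-- crossing cycle leaves G₁ along c and must return through v₁; every other
-- cycle lies on one side, as for ⊙_V.
module VertexEdgeJoin (G₁ G₂ : Graph)
  (decE₁ : DecidableEquality (E G₁)) (decE₂ : DecidableEquality (E G₂))
  (dec₁ : DecidableEquality (V G₁)) (dec₂ : DecidableEquality (V G₂))
  (e₁ : E G₁) (u₁ v₁ : V G₁) (J₁ : Joins G₁ e₁ u₁ v₁) (u₁≢v₁ : u₁ ≢ v₁)
  (e₂ : E G₂) (u₂ v₂ : V G₂) (J₂ : Joins G₂ e₂ u₂ v₂) (u₂≢v₂ : u₂ ≢ v₂) where

  open Gluing dec₂ v₂ v₁ using (g; g-glued; g-inj₁; g-injective; g-unglued; g-in-image)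

  open EdgeJoin G₁ G₂ decE₁ decE₂ e₁ u₁ v₁ J₁ u₁≢v₁ e₂ u₂ v₂ J₂ u₂≢v₂
         tt [] exact-⊤
         (V G₁ ⊎ (V G₂ ∖ v₂)) (ends (joinVE G₁ e₁ u₁ v₁ G₂ dec₂ e₂ u₂ v₂))
         inj₁ inj₁-injective g g-injective (λ _ → refl) (λ _ → refl) refl
    public

  module Glued = GluedSides E₁.G′ E₂.G′ dec₁ dec₂ v₁ v₂ (ends H)
                   ι₁ inj₁-injective (λ _ → refl) ι₂ (inj₁-injective ∘ inj₂-injective) (λ _ → refl)

  c : E H
  c = new tt

  -- a cycle without the new edge stays on the side of its closing edge,
  -- by the cut argument for the identified vertex
  one-side : (C : CycleWalk {H}) → (∀ {s} → new s ∉ cycleEdges C) → OnOneSide C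
  one-side C@(mkCycleWalk (inj₁ f) _ P _ _ _) fresh =
    inj₁ (Glued.Side₁.classify C (f , refl) (old-edges (edges P) (fresh ∘ there)))
  one-side C@(mkCycleWalk (inj₂ (inj₁ f)) _ P _ _ _) fresh =
    inj₂ (Glued.Side₂.classify C (f , refl) (All.map ⊎-swap (old-edges (edges P) (fresh ∘ there))))
  one-side (mkCycleWalk (inj₂ (inj₂ tt)) _ _ _ _ _) fresh = ⊥-elim (fresh (here refl))

  -- The crossing walk u₁ ⋯ u₂ of a decomposition D passes through the
  -- identified vertex v₁ = v₂, and splits there into a path of G₁ and a path
  -- of G₂.
  module CutAtV₁ (D : Decomposition {H}) where
    cw : CrossingWalk (Decomposition.cycles D)
    cw = crossingWalk D
    open CrossingWalk cw public
    old-walk : ∀ {s} → new s ∉ edges walk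
    old-walk {tt} = Unique[x∷xs]⇒x∉xs edges-unique
    inj₁≢inj₂ : ∀ {a r} → _≡_ {A = V H} (inj₁ a) (inj₂ r) → ⊥
    inj₁≢inj₂ ()
    cut-at-v₁ : Dec (inj₁ v₁ ∈ vertices walk) → CutOpen (Decomposition.cycles D)
    cut-at-v₁ (no v₁∉walk) = ⊥-elim (inj₁≢inj₂ (trans (proj₂ reached) (proj₂ (g-unglued u₂≢v₂))))
      where
      avoid : ∀ {v} → v ∈ sources walk → v ≢ inj₁ v₁
      avoid v∈ refl = v₁∉walk (sources⊆vertices walk v∈)
      reached : Glued.InG₁ (g u₂)
      reached = proj₂ (Glued.Side₁.forward walk (u₁ , refl) avoid (old-edges (edges walk) old-walk))
    cut-at-v₁ (yes v₁∈walk) = record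
      { walk₁ = Q₁.walk ; y₁≡v₁ = inj₁-injective Q₁.end≡
      ; walk₂ = Q₂.walk ; y₂≡u₂ = g-injective Q₂.end≡
      ; vertices-unique₁ = unique-map⁻ (subst Unique (sym Q₁.vertices≡) unique-before)
      ; vertices-unique₂ = unique-map⁻ {f = g}
                             (subst Unique (sym Q₂.vertices≡) (unique-++ʳ (sources before) unique′))
      ; rest = rest ; rest-sides = all-on-one-side one-side rest fresh-rest
      ; edges↭ = subst (λ l → allEdges (Decomposition.cycles D) ↭ l ++ allEdges rest) crossing≡ edges↭
      ; length≡ = length≡ }
      where
      split : VertexSplit walk (inj₁ v₁)
      split = splitAtVertex walk v₁∈walk
      open VertexSplit split
      unique′ : Unique (sources before ++ vertices after)
      unique′ = subst Unique vertices≡ vertices-unique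
      avoids : (∀ {u} → u ∈ sources before → u ≢ inj₁ v₁) × (∀ {u} → u ∈ targets after → u ≢ inj₁ v₁)
      avoids = split-avoids walk vertices-unique split
      unique-before : Unique (vertices before)
      unique-before = subst Unique (sym (vertices≡sources∷ʳ before))
        (++⁺ (unique-++ˡ (sources before) unique′) ([] ∷ []) λ { (v∈ , here refl) → proj₁ avoids v∈ refl })
      old-before : ∀ {s} → new s ∉ edges before
      old-before {tt} m = old-walk (subst (_ ∈_) (sym edges≡) (∈-++⁺ˡ m))
      old-after : ∀ {s} → new s ∉ edges after
      old-after {tt} m = old-walk (subst (_ ∈_) (sym edges≡) (∈-++⁺ʳ (edges before) m))
      fresh-rest : ∀ {s} → new s ∉ allEdges rest
      fresh-rest {tt} = crossing-fresh D cw (here refl)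
      in-G₁ : All P₁.InImage (edges before)
      in-G₁ = proj₁ (Glued.Side₁.forward before (u₁ , refl) (proj₁ avoids) (old-edges (edges before) old-before))
      in-G₂ : All P₂.InImage (edges after)
      in-G₂ = proj₁ (Glued.Side₂.backward after (g-in-image u₂) (proj₂ avoids)
                       (All.map ⊎-swap (old-edges (edges after) old-after)))
      module Q₁ = P₁.PulledWalk (P₁.pullWalk before refl in-G₁)
      module Q₂ = P₂.PulledWalk (P₂.pullWalk after g-glued in-G₂)
      crossing≡ : c ∷ edges walk ≡ crossing (edges Q₁.walk) (edges Q₂.walk)
      crossing≡ = cong (c ∷_) (trans edges≡ (cong₂ _++_ (sym Q₁.edges≡) (sym Q₂.edges≡)))

  cutOpen : (D : Decomposition {H}) → CutOpen (Decomposition.cycles D)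
  cutOpen D = cut-at-v₁ (any? (Glued.decH (inj₁ v₁)) (vertices walk))
    where open CutAtV₁ D

  crossingCycle : CrossingCycle
  crossingCycle w₁ w₂ uV₁ uV₂ uE =
    mkCycleWalk c (inj₂ refl) Q
      (subst (λ l → 1 ≤ length l) (sym edges≡)
        (nonempty-++ (map ι₁ (edges w₁)) _
          (subst (1 ≤_) (sym (length-map ι₁ (edges w₁))) (walk-nonempty w₁ u₁≢v₁))))
      (subst Unique (sym vertices≡) unique-vertices)
      (subst (λ l → Unique (c ∷ l)) (sym edges≡) uE) ,
    cong (c ∷_) edges≡
    where
    W₂ : Walk {H} (inj₁ v₁) (g u₂)
    W₂ = castᵂ g-glued refl (P₂.pushWalk w₂)
    Q : Walk {H} (inj₁ u₁) (g u₂)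
    Q = P₁.pushWalk w₁ ++ᵂ W₂
    edges≡ : edges Q ≡ map ι₁ (edges w₁) ++ map ι₂ (edges w₂)
    edges≡ = trans (edges-++ᵂ (P₁.pushWalk w₁) W₂)
                   (cong₂ _++_ (P₁.edges-pushWalk w₁) (trans (edges-castᵂ g-glued refl _) (P₂.edges-pushWalk w₂)))
    vertices≡ : vertices Q ≡ map inj₁ (sources w₁) ++ map g (vertices w₂)
    vertices≡ = trans (vertices-++ᵂ (P₁.pushWalk w₁) W₂)
                      (cong₂ _++_ (P₁.sources-pushWalk w₁)
                                  (trans (vertices-castᵂ g-glued refl _) (P₂.vertices-pushWalk w₂)))
    unique₁ : Unique (sources w₁ ++ [ v₁ ])
    unique₁ = subst Unique (vertices≡sources∷ʳ w₁) uV₁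
    -- only the identified vertex could be shared, and it ends the first path
    disjoint : Disjoint (map inj₁ (sources w₁)) (map g (vertices w₂))
    disjoint (m₁ , m₂) with ∈-map⁻ inj₁ m₁ | ∈-map⁻ g m₂
    ... | (s , s∈ , refl) | (q , _ , inj₁s≡gq) =
      unique-++-disjoint (sources w₁) unique₁ (subst (_∈ _) (proj₂ (g-inj₁ (sym inj₁s≡gq))) s∈ , here refl)
    unique-vertices : Unique (map inj₁ (sources w₁) ++ map g (vertices w₂))
    unique-vertices = ++⁺ (unique-map⁺ inj₁-injective (unique-++ˡ (sources w₁) unique₁))
                          (unique-map⁺ g-injective uV₂) disjoint

  vertexEdgeJoinCorrespondence : SizeCorrespondence G₁ G₂ (joinVE G₁ e₁ u₁ v₁ G₂ dec₂ e₂ u₂ v₂) 1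
  vertexEdgeJoinCorrespondence = correspondence crossingCycle cutOpen

module _ {G : Graph} where

  witness : ∀ {n} {Bound : CycleDecomposition G → Set} →
            (Σ (CycleDecomposition G) λ D → count D ≡ n) × (∀ D → Bound D) →
            Σ (Decomposition {G}) λ L → size L ≡ n
  witness ((D , count≡) , _) = let (L , size≡) = toDecomposition D in L , trans size≡ count≡

  realise : ∀ {n} → (Σ (Decomposition {G}) λ L → size L ≡ n) → Σ (CycleDecomposition G) λ D → count D ≡ n
  realise (L , size≡) = let (D , count≡) = fromDecomposition L in D , trans count≡ size≡

  min-bound : ∀ {c} → IsMinCycleNumber G c → (L : Decomposition {G}) → c ≤ size L
  min-bound (_ , bound) L = let (D , count≡) = fromDecomposition L in subst (_ ≤_) count≡ (bound D)

  max-bound : ∀ {c} → IsMaxCycleNumber G c → (L : Decomposition {G}) → size L ≤ c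
  max-bound (_ , bound) L = let (D , count≡) = fromDecomposition L in subst (_≤ _) count≡ (bound D)

module Transfer {G₁ G₂ H : Graph} {k : ℕ} (S : SizeCorrespondence G₁ G₂ H k) where
  open SizeCorrespondence S

  cancel-offset : ∀ {a b} → a ≡ k + b → b ≡ a ∸ k
  cancel-offset {b = b} refl = sym (m+n∸m≡n k b)

  composed : ∀ {c₁ c₂} → (Σ (Decomposition {G₁}) λ L → size L ≡ c₁) →
             (Σ (Decomposition {G₂}) λ L → size L ≡ c₂) →
             Σ (Decomposition {H}) λ L → size L ≡ c₁ + c₂ ∸ k
  composed (L₁ , refl) (L₂ , refl) = let (L , sizes) = compose L₁ L₂ in L , cancel-offset sizes

  split : (D : CycleDecomposition H) → Σ (Decomposition {G₁}) λ L₁ → Σ (Decomposition {G₂}) λ L₂ →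
          size L₁ + size L₂ ∸ k ≡ count D
  split D =
    let (L , count≡) = toDecomposition D
        (L₁ , L₂ , sizes) = decompose L
    in L₁ , L₂ , trans (sym (cancel-offset sizes)) count≡

  -- minimum: compose minimum decompositions; every decomposition of H splits
  -- into two whose sizes are bounded below by c₁ and c₂
  min-transfer : ∀ {c₁ c₂} → IsMinCycleNumber G₁ c₁ → IsMinCycleNumber G₂ c₂ → IsMinCycleNumber H (c₁ + c₂ ∸ k)
  min-transfer h₁ h₂ = realise (composed (witness h₁) (witness h₂)) , λ D →
    let (L₁ , L₂ , count≡) = split D
    in subst (_ ≤_) count≡ (∸-monoˡ-≤ k (+-mono-≤ (min-bound h₁ L₁) (min-bound h₂ L₂)))

  max-transfer : ∀ {ν₁ ν₂} → IsMaxCycleNumber G₁ ν₁ → IsMaxCycleNumber G₂ ν₂ → IsMaxCycleNumber H (ν₁ + ν₂ ∸ k)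
  max-transfer h₁ h₂ = realise (composed (witness h₁) (witness h₂)) , λ D →
    let (L₁ , L₂ , count≡) = split D
    in subst (_≤ _) count≡ (∸-monoˡ-≤ k (+-mono-≤ (max-bound h₁ L₁) (max-bound h₂ L₂)))

ends-distinct : {G : Graph} → Loopless G → ∀ {e u v} → Joins G e u v → u ≢ v
ends-distinct loopless {e} (inj₁ p) refl = loopless e (trans (cong proj₁ p) (sym (cong proj₂ p)))
ends-distinct loopless {e} (inj₂ p) refl = loopless e (trans (cong proj₁ p) (sym (cong proj₂ p)))

-- Finiteness supplies decidable equality of vertices and
-- edges, looplessness the distinctness of the ends of e₁ and e₂.
mainTheorem6 :
    (G₁ G₂ : Graph) →
    (fin₁ : Finite G₁) → (fin₂ : Finite G₂) →
    Loopless G₁ → Loopless G₂ →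
    Eulerian G₁ → Eulerian G₂ →
    (w₁ : V G₁) → (w₂ : V G₂) →
    (e₁ : E G₁) → (u₁ v₁ : V G₁) → Joins G₁ e₁ u₁ v₁ →
    (e₂ : E G₂) → (u₂ v₂ : V G₂) → Joins G₂ e₂ u₂ v₂ →
    (c₁ ν₁ c₂ ν₂ : ℕ) →
    IsMinCycleNumber G₁ c₁ → IsMaxCycleNumber G₁ ν₁ →
    IsMinCycleNumber G₂ c₂ → IsMaxCycleNumber G₂ ν₂ →
    let dec₂ = finDecEq (proj₂ (proj₁ fin₂)) in
    (IsMinCycleNumber (joinV G₁ w₁ G₂ dec₂ w₂) (c₁ + c₂)
      × IsMaxCycleNumber (joinV G₁ w₁ G₂ dec₂ w₂) (ν₁ + ν₂))
    × (IsMinCycleNumber (joinE G₁ e₁ u₁ v₁ G₂ e₂ u₂ v₂) (c₁ + c₂ ∸ 1)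
      × IsMinCycleNumber (joinVE G₁ e₁ u₁ v₁ G₂ dec₂ e₂ u₂ v₂) (c₁ + c₂ ∸ 1)
      × IsMaxCycleNumber (joinE G₁ e₁ u₁ v₁ G₂ e₂ u₂ v₂) (ν₁ + ν₂ ∸ 1)
      × IsMaxCycleNumber (joinVE G₁ e₁ u₁ v₁ G₂ dec₂ e₂ u₂ v₂) (ν₁ + ν₂ ∸ 1))
mainTheorem6 G₁ G₂ fin₁ fin₂ loopless₁ loopless₂ _ _ w₁ w₂ e₁ u₁ v₁ J₁ e₂ u₂ v₂ J₂
             c₁ ν₁ c₂ ν₂ hc₁ hν₁ hc₂ hν₂ =
  (ByV.min-transfer hc₁ hc₂ , ByV.max-transfer hν₁ hν₂) ,
  (ByE.min-transfer hc₁ hc₂ , ByVE.min-transfer hc₁ hc₂ , ByE.max-transfer hν₁ hν₂ , ByVE.max-transfer hν₁ hν₂)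
  where
  decV₁ : DecidableEquality (V G₁)
  decV₁ = finDecEq (proj₂ (proj₁ fin₁))
  decV₂ : DecidableEquality (V G₂)
  decV₂ = finDecEq (proj₂ (proj₁ fin₂))
  decE₁ : DecidableEquality (E G₁)
  decE₁ = finDecEq (proj₂ (proj₂ fin₁))
  decE₂ : DecidableEquality (E G₂)
  decE₂ = finDecEq (proj₂ (proj₂ fin₂))
  u₁≢v₁ : u₁ ≢ v₁
  u₁≢v₁ = ends-distinct {G₁} loopless₁ J₁
  u₂≢v₂ : u₂ ≢ v₂
  u₂≢v₂ = ends-distinct {G₂} loopless₂ J₂
  module ByV  = Transfer (VertexJoin.vertexJoinCorrespondence G₁ G₂ decV₁ decV₂ w₁ w₂)
  module ByE  = Transfer (EdgeEdgeJoin.edgeJoinCorrespondence G₁ G₂ decE₁ decE₂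
                            e₁ u₁ v₁ J₁ u₁≢v₁ e₂ u₂ v₂ J₂ u₂≢v₂)
  module ByVE = Transfer (VertexEdgeJoin.vertexEdgeJoinCorrespondence G₁ G₂ decE₁ decE₂ decV₁ decV₂
                            e₁ u₁ v₁ J₁ u₁≢v₁ e₂ u₂ v₂ J₂ u₂≢v₂)
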